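{- Let $q$ be an odd prime power and $\mathbb{A}=\mathbb{F}_q[X]$. Let $f=aP^e$, where $a\in\mathbb{F}_q^*$, $P\in\mathbb{A}$ is a monic irreducible polynomial and $e\ge1$ is an integer. Then $$M(f)\equiv(-1)^{\frac{(e-1)(q-1)}{2}\deg P}M(P)\pmod P.$$
   Context: For $f\in\mathbb{A}$ with $\deg f\ge1$, $M(f)=\Big(\prod g\Big)^{(q-1)/2}$, the product over all monic $g\in\mathbb{A}$ with $0\le\deg g<\deg f$ and $\gcd(g,f)=1$. -}

module Defs where

open import Level using (Level; _⊔_)
open import Algebra.Bundles using (CommutativeRing)
open import Data.Nat as ℕ using (ℕ; zero; suc; _∸_; _<_)
open import Data.Nat.DivMod using (_/_)
open import Data.List using (List; []; _∷_; length; foldr; map)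
open import Data.List.Relation.Unary.Any using (Any)
open import Data.List.Relation.Unary.All using (All; all?)
open import Data.List.Relation.Unary.AllPairs using (AllPairs)
open import Data.Product using (Σ; _×_; ∃)
open import Data.Sum using (_⊎_)
open import Relation.Nullary using (¬_; Dec; yes; no)
open import Relation.Binary.PropositionalEquality using (_≡_)
open import Relation.Binary.Definitions using (Decidable)

record FiniteField (c ℓ : Level) : Set (Level.suc (c ⊔ ℓ)) where
  field
    commRing : CommutativeRing c ℓ
  open CommutativeRing commRing public
  field
    1≉0      : ¬ (1# ≈ 0#)
    inverse  : ∀ x → ¬ (x ≈ 0#) → Σ Carrier λ y → (x * y) ≈ 1#
    _≟_      : Decidable _≈_
    elements : List Carrier
    complete : ∀ x → Any (x ≈_) elements
    distinct : AllPairs (λ x y → ¬ (x ≈ y)) elements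

  card : ℕ
  card = length elements

-- Polynomials over a finite field F, as coefficient lists (constant term
-- first).  Equality is coefficientwise (trailing zeros irrelevant).

module Poly {c ℓ} (F : FiniteField c ℓ) where
  open FiniteField F

  Pol : Set c
  Pol = List Carrier

  coeff : Pol → ℕ → Carrier
  coeff []       _       = 0#
  coeff (a ∷ p)  zero    = a
  coeff (a ∷ p)  (suc i) = coeff p i

  _≈ₚ_ : Pol → Pol → Set ℓ
  p ≈ₚ r = ∀ i → coeff p i ≈ coeff r i

  infix 4 _≈ₚ_
  infixl 6 _+ₚ_ _-ₚ_
  infixl 7 _*ₚ_

  isZero? : (p : Pol) → Dec (All (_≈ 0#) p)
  isZero? p = all? (λ x → x ≟ 0#) p

  -- degree (the zero polynomial gets degree 0; it is never used with
  -- the zero polynomial in the statement where it matters)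
  deg : Pol → ℕ
  deg []      = 0
  deg (a ∷ p) with isZero? p
  ... | yes _ = 0
  ... | no  _ = suc (deg p)

  lead : Pol → Carrier
  lead p = coeff p (deg p)

  Monic : Pol → Set ℓ
  Monic p = lead p ≈ 1#

  const : Carrier → Pol
  const a = a ∷ []

  1ₚ : Pol
  1ₚ = const 1#

  _+ₚ_ : Pol → Pol → Pol
  []      +ₚ r       = r
  (a ∷ p) +ₚ []      = a ∷ p
  (a ∷ p) +ₚ (b ∷ r) = (a + b) ∷ (p +ₚ r)

  -ₚ_ : Pol → Pol
  -ₚ_ = map (-_)

  _-ₚ_ : Pol → Pol → Pol
  p -ₚ r = p +ₚ (-ₚ r)

  _*ₚ_ : Pol → Pol → Pol
  []      *ₚ r = []
  (a ∷ p) *ₚ r = map (a *_) r +ₚ (0# ∷ (p *ₚ r))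

  _^ₚ_ : Pol → ℕ → Pol
  p ^ₚ zero  = 1ₚ
  p ^ₚ suc n = p *ₚ (p ^ₚ n)

  prodₚ : List Pol → Pol
  prodₚ = foldr _*ₚ_ 1ₚ

  _∣ₚ_ : Pol → Pol → Set (c ⊔ ℓ)
  d ∣ₚ g = Σ Pol λ h → g ≈ₚ d *ₚ h

  _≡_[modₚ_] : Pol → Pol → Pol → Set (c ⊔ ℓ)
  A ≡ B [modₚ P ] = P ∣ₚ (A -ₚ B)

  Irreducible : Pol → Set (c ⊔ ℓ)
  Irreducible P = (1 ℕ.≤ deg P)
                × (∀ g h → P ≈ₚ g *ₚ h → deg g ≡ 0 ⊎ deg h ≡ 0)

  Coprime : Pol → Pol → Set (c ⊔ ℓ)
  Coprime g f = ∀ d → d ∣ₚ g → d ∣ₚ f → deg d ≡ 0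

  InM : Pol → Pol → Set (c ⊔ ℓ)
  InM f g = Monic g × (deg g < deg f) × Coprime g f

  Enumerates : ∀ {s} → (Pol → Set s) → List Pol → Set (c ⊔ ℓ ⊔ s)
  Enumerates S L = All S L
                 × (∀ g → S g → Any (g ≈ₚ_) L)
                 × AllPairs (λ g h → ¬ (g ≈ₚ h)) L

  -- M(f) = (∏ g)^((q-1)/2), given an enumeration L of the index set
  Mof : List Pol → Pol
  Mof L = prodₚ L ^ₚ ((card ∸ 1) / 2)

  signPow : ℕ → Carrier
  signPow zero    = 1#
  signPow (suc k) = - 1# * signPow k

{-# OPTIONS --safe #-}
-- Write d = deg P. As P is irreducible, a monic g is coprime to a·P^e exactly when
-- P ∤ g, so it suffices to compare the products of the monic g with P ∤ g of degree
-- < e·d and of degree < d. For n ≥ d, sort the monic g of degree n with P ∤ g by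
-- their quotient h on division by P: the fibre over h is {P·h + r : r ≠ 0, deg r < d},
-- which reduction mod P maps bijectively onto (A/P)^×. By Wilson's theorem in the
-- field A/P every fibre has product ≡ -1, and there are q^(n-d) fibres, an odd
-- number, so every degree n ≥ d contributes a factor -1. Hence the product over
-- deg g < e·d is (-1)^((e-1)d) times the one over deg g < d; raise to the (q-1)/2.
module Submission where

open import Level using (_⊔_)
open import Algebra.Bundles using (CommutativeRing; CommutativeMonoid)
open import Data.Empty using (⊥-elim)
open import Data.Integer as ℤ using (ℤ; +_; -[1+_]; _⊖_; _◃_)
import Data.Integer.Properties as ℤ
import Data.List.Properties as Listₚ
open import Data.List as List using (List; []; _∷_; map; filter; length; _++_; foldr)
open import Data.List.Relation.Unary.All as All using (All; []; _∷_)
import Data.List.Relation.Unary.All.Properties as Allₚ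
open import Data.List.Relation.Unary.Any as Any using (Any; here; there; _─_)
import Data.List.Relation.Unary.Any.Properties as Anyₚ
open import Data.List.Relation.Unary.AllPairs as AllPairs using (AllPairs; []; _∷_)
import Data.List.Relation.Unary.AllPairs.Properties as AllPairsₚ
open import Data.Maybe using (Maybe; just; nothing)
open import Data.Nat as ℕ using (ℕ; zero; suc; _≤_; _<_; z≤n; s≤s; _∸_; _/_; _%_)
import Data.Nat.Properties as ℕ
open import Data.Product using (Σ; _×_; _,_; proj₁; proj₂)
open import Data.Sign as Sign using (Sign)
open import Data.Sum using (_⊎_; inj₁; inj₂)
open import Relation.Binary.Bundles using (Setoid)
open import Relation.Binary.PropositionalEquality as ≡ using (_≡_)
open import Relation.Nullary using (¬_; Dec; yes; no)
import Relation.Unary as Unary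
open import Relation.Unary.Properties using (∁?)

open import Defs

module IntegerRingSolver {c ℓ} (R : CommutativeRing c ℓ) where
  open CommutativeRing R
  open import Algebra.Properties.Ring ring
  open import Algebra.Properties.Semiring.Mult semiring using (×-homo-+; ×1-homo-*) renaming (_×_ to _×ₙ_)
  open import Algebra.Solver.Ring.AlmostCommutativeRing
  open import Relation.Binary.Reasoning.Setoid setoid

  fromℕ : ℕ → Carrier
  fromℕ n = n ×ₙ 1#

  fromℤ : ℤ → Carrier
  fromℤ (+ n)      = fromℕ n
  fromℤ -[1+ n ]   = - fromℕ (suc n)

  -‿cancel-1+ : ∀ a b → (1# + a) - (1# + b) ≈ a - b
  -‿cancel-1+ a b = begin
    (1# + a) - (1# + b)     ≈⟨ +-congˡ (sym (-‿+-comm 1# b)) ⟩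
    (1# + a) + (- 1# - b)   ≈⟨ +-assoc _ _ _ ⟩
    1# + (a + (- 1# - b))   ≈⟨ +-congˡ (sym (+-assoc _ _ _)) ⟩
    1# + ((a - 1#) - b)     ≈⟨ +-congˡ (+-congʳ (+-comm _ _)) ⟩
    1# + ((- 1# + a) - b)   ≈⟨ +-congˡ (+-assoc _ _ _) ⟩
    1# + (- 1# + (a - b))   ≈⟨ sym (+-assoc _ _ _) ⟩
    (1# - 1#) + (a - b)     ≈⟨ +-congʳ (-‿inverseʳ 1#) ⟩
    0# + (a - b)            ≈⟨ +-identityˡ _ ⟩
    a - b                   ∎

  fromℤ-⊖ : ∀ m n → fromℤ (m ⊖ n) ≈ fromℕ m - fromℕ n
  fromℤ-⊖ m       zero    = sym (trans (+-congˡ -0#≈0#) (+-identityʳ _))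
  fromℤ-⊖ zero    (suc n) = sym (+-identityˡ _)
  fromℤ-⊖ (suc m) (suc n) rewrite ℤ.[1+m]⊖[1+n]≡m⊖n m n =
    trans (fromℤ-⊖ m n) (sym (-‿cancel-1+ (fromℕ m) (fromℕ n)))

  fromℤ-+ : ∀ i j → fromℤ (i ℤ.+ j) ≈ fromℤ i + fromℤ j
  fromℤ-+ -[1+ m ] -[1+ n ] = begin
    - fromℕ (suc (suc m ℕ.+ n))          ≈⟨ -‿cong (+-congˡ (×-homo-+ 1# (suc m) n)) ⟩
    - (1# + (fromℕ (suc m) + fromℕ n))   ≈⟨ -‿cong (trans (sym (+-assoc _ _ _)) (trans (+-congʳ (+-comm _ _)) (+-assoc _ _ _))) ⟩
    - (fromℕ (suc m) + fromℕ (suc n))    ≈⟨ sym (-‿+-comm _ _) ⟩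
    - fromℕ (suc m) - fromℕ (suc n)      ∎
  fromℤ-+ -[1+ m ] (+ n)    = trans (fromℤ-⊖ n (suc m)) (+-comm _ _)
  fromℤ-+ (+ m)    -[1+ n ] = fromℤ-⊖ m (suc n)
  fromℤ-+ (+ m)    (+ n)    = ×-homo-+ 1# m n

  fromℤ-neg : ∀ i → fromℤ (ℤ.- i) ≈ - fromℤ i
  fromℤ-neg (+ zero)  = sym -0#≈0#
  fromℤ-neg (+ suc n) = refl
  fromℤ-neg -[1+ n ]  = sym (-‿involutive _)

  fromℤ-◃ : ∀ n → fromℤ (Sign.- ◃ n) ≈ - fromℕ n
  fromℤ-◃ zero    = sym -0#≈0#
  fromℤ-◃ (suc n) = refl

  fromℤ-* : ∀ i j → fromℤ (i ℤ.* j) ≈ fromℤ i * fromℤ j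
  fromℤ-* (+ m) (+ n) rewrite ℤ.+◃n≡+n (m ℕ.* n) = ×1-homo-* m n
  fromℤ-* (+ m) -[1+ n ] = begin
    fromℤ (Sign.- ◃ (m ℕ.* suc n))     ≈⟨ fromℤ-◃ (m ℕ.* suc n) ⟩
    - fromℕ (m ℕ.* suc n)              ≈⟨ -‿cong (×1-homo-* m (suc n)) ⟩
    - (fromℕ m * fromℕ (suc n))        ≈⟨ -‿distribʳ-* _ _ ⟩
    fromℕ m * - fromℕ (suc n)          ∎
  fromℤ-* -[1+ m ] (+ n) = begin
    fromℤ (Sign.- ◃ (suc m ℕ.* n))     ≈⟨ fromℤ-◃ (suc m ℕ.* n) ⟩
    - fromℕ (suc m ℕ.* n)              ≈⟨ -‿cong (×1-homo-* (suc m) n) ⟩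
    - (fromℕ (suc m) * fromℕ n)        ≈⟨ -‿distribˡ-* _ _ ⟩
    - fromℕ (suc m) * fromℕ n          ∎
  fromℤ-* -[1+ m ] -[1+ n ] = begin
    fromℕ (suc m ℕ.* suc n)              ≈⟨ ×1-homo-* (suc m) (suc n) ⟩
    fromℕ (suc m) * fromℕ (suc n)        ≈⟨ sym (-‿involutive _) ⟩
    - - (fromℕ (suc m) * fromℕ (suc n))  ≈⟨ -‿cong (-‿distribˡ-* _ _) ⟩
    - (- fromℕ (suc m) * fromℕ (suc n))  ≈⟨ -‿distribʳ-* _ _ ⟩
    - fromℕ (suc m) * - fromℕ (suc n)    ∎

  fromℤ-homomorphism : ℤ.+-*-rawRing -Raw-AlmostCommutative⟶ fromCommutativeRing R
  fromℤ-homomorphism = record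
    { ⟦_⟧    = fromℤ
    ; +-homo = fromℤ-+
    ; *-homo = fromℤ-*
    ; -‿homo = fromℤ-neg
    ; 0-homo = refl
    ; 1-homo = +-identityʳ 1#
    }

  fromℤ-≟ : ∀ i j → Maybe (fromℤ i ≈ fromℤ j)
  fromℤ-≟ i j with i ℤ.≟ j
  ... | yes ≡.refl = just refl
  ... | no _       = nothing

  open import Algebra.Solver.Ring ℤ.+-*-rawRing (fromCommutativeRing R) fromℤ-homomorphism fromℤ-≟ public

module PolynomialRing {c ℓ} (F : FiniteField c ℓ) where
  open FiniteField F hiding (zero)
  open Poly F
  open import Algebra.Properties.Ring ring using (-0#≈0#)
  open import Relation.Binary.Reasoning.Setoid setoid

  infixr 7 _·ₚ_
  _·ₚ_ : Carrier → Pol → Pol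
  a ·ₚ p = map (a *_) p

  X·_ : Pol → Pol
  X· p = 0# ∷ p

  -- A record around _≈ₚ_, so that the polynomials are recoverable from the type.
  infix 4 _≋_
  record _≋_ (p r : Pol) : Set ℓ where
    constructor mk≋
    field coeff-≈ : p ≈ₚ r
  open _≋_ public

  ≋-refl : ∀ {p} → p ≋ p
  ≋-refl = mk≋ (λ i → refl)

  ≋-sym : ∀ {p r} → p ≋ r → r ≋ p
  ≋-sym e = mk≋ (λ i → sym (coeff-≈ e i))

  ≋-trans : ∀ {p r s} → p ≋ r → r ≋ s → p ≋ s
  ≋-trans e f = mk≋ (λ i → trans (coeff-≈ e i) (coeff-≈ f i))

  coeff-+ₚ : ∀ p r i → coeff (p +ₚ r) i ≈ coeff p i + coeff r i
  coeff-+ₚ []      r       i       = sym (+-identityˡ _)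
  coeff-+ₚ (a ∷ p) []      i       = sym (+-identityʳ _)
  coeff-+ₚ (a ∷ p) (b ∷ r) zero    = refl
  coeff-+ₚ (a ∷ p) (b ∷ r) (suc i) = coeff-+ₚ p r i

  coeff-·ₚ : ∀ a p i → coeff (a ·ₚ p) i ≈ a * coeff p i
  coeff-·ₚ a []      i       = sym (zeroʳ a)
  coeff-·ₚ a (b ∷ p) zero    = refl
  coeff-·ₚ a (b ∷ p) (suc i) = coeff-·ₚ a p i

  coeff-neg : ∀ p i → coeff (-ₚ p) i ≈ - coeff p i
  coeff-neg []      i       = sym -0#≈0#
  coeff-neg (a ∷ p) zero    = refl
  coeff-neg (a ∷ p) (suc i) = coeff-neg p i

  ∷-cong : ∀ {a b p r} → a ≈ b → p ≋ r → (a ∷ p) ≋ (b ∷ r)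
  ∷-cong a≈b p≋r = mk≋ λ { zero → a≈b ; (suc i) → coeff-≈ p≋r i }

  ∷-injectiveʳ : ∀ {a b p r} → (a ∷ p) ≋ (b ∷ r) → p ≋ r
  ∷-injectiveʳ e = mk≋ (λ i → coeff-≈ e (suc i))

  ∷-zero : ∀ {a p} → (a ∷ p) ≋ [] → p ≋ []
  ∷-zero e = mk≋ (λ i → coeff-≈ e (suc i))

  X·-cong : ∀ {p r} → p ≋ r → X· p ≋ X· r
  X·-cong = ∷-cong refl

  X·-zero : ∀ {p} → p ≋ [] → X· p ≋ []
  X·-zero p≋0 = mk≋ λ { zero → refl ; (suc i) → coeff-≈ p≋0 i }

  +ₚ-cong : ∀ {p p′ r r′} → p ≋ p′ → r ≋ r′ → (p +ₚ r) ≋ (p′ +ₚ r′)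
  +ₚ-cong {p} {p′} {r} {r′} e f =
    mk≋ (λ i → trans (coeff-+ₚ p r i) (trans (+-cong (coeff-≈ e i) (coeff-≈ f i)) (sym (coeff-+ₚ p′ r′ i))))

  ·ₚ-cong : ∀ {a b p r} → a ≈ b → p ≋ r → (a ·ₚ p) ≋ (b ·ₚ r)
  ·ₚ-cong {a} {b} {p} {r} e f =
    mk≋ (λ i → trans (coeff-·ₚ a p i) (trans (*-cong e (coeff-≈ f i)) (sym (coeff-·ₚ b r i))))

  -ₚ-cong : ∀ {p r} → p ≋ r → (-ₚ p) ≋ (-ₚ r)
  -ₚ-cong {p} {r} e = mk≋ (λ i → trans (coeff-neg p i) (trans (-‿cong (coeff-≈ e i)) (sym (coeff-neg r i))))

  +ₚ-assoc : ∀ p r s → ((p +ₚ r) +ₚ s) ≋ (p +ₚ (r +ₚ s))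
  +ₚ-assoc p r s = mk≋ λ i → begin
    coeff ((p +ₚ r) +ₚ s) i              ≈⟨ trans (coeff-+ₚ (p +ₚ r) s i) (+-congʳ (coeff-+ₚ p r i)) ⟩
    (coeff p i + coeff r i) + coeff s i  ≈⟨ +-assoc _ _ _ ⟩
    coeff p i + (coeff r i + coeff s i)  ≈⟨ sym (trans (coeff-+ₚ p (r +ₚ s) i) (+-congˡ (coeff-+ₚ r s i))) ⟩
    coeff (p +ₚ (r +ₚ s)) i              ∎

  +ₚ-comm : ∀ p r → (p +ₚ r) ≋ (r +ₚ p)
  +ₚ-comm p r = mk≋ (λ i → trans (coeff-+ₚ p r i) (trans (+-comm _ _) (sym (coeff-+ₚ r p i))))

  +ₚ-identityʳ : ∀ p → (p +ₚ []) ≋ p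
  +ₚ-identityʳ p = mk≋ (λ i → trans (coeff-+ₚ p [] i) (+-identityʳ _))

  -ₚ-inverseˡ : ∀ p → ((-ₚ p) +ₚ p) ≋ []
  -ₚ-inverseˡ p = mk≋ (λ i → trans (coeff-+ₚ (-ₚ p) p i) (trans (+-congʳ (coeff-neg p i)) (-‿inverseˡ _)))

  -ₚ-inverseʳ : ∀ p → (p +ₚ (-ₚ p)) ≋ []
  -ₚ-inverseʳ p = mk≋ (λ i → trans (coeff-+ₚ p (-ₚ p) i) (trans (+-congˡ (coeff-neg p i)) (-‿inverseʳ _)))

  ·ₚ-distribˡ : ∀ a p r → (a ·ₚ (p +ₚ r)) ≋ (a ·ₚ p +ₚ a ·ₚ r)
  ·ₚ-distribˡ a p r = mk≋ λ i → begin
    coeff (a ·ₚ (p +ₚ r)) i          ≈⟨ trans (coeff-·ₚ a (p +ₚ r) i) (*-congˡ (coeff-+ₚ p r i)) ⟩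
    a * (coeff p i + coeff r i)      ≈⟨ distribˡ _ _ _ ⟩
    a * coeff p i + a * coeff r i    ≈⟨ sym (trans (coeff-+ₚ (a ·ₚ p) (a ·ₚ r) i) (+-cong (coeff-·ₚ a p i) (coeff-·ₚ a r i))) ⟩
    coeff (a ·ₚ p +ₚ a ·ₚ r) i       ∎

  ·ₚ-distribʳ : ∀ a b p → ((a + b) ·ₚ p) ≋ (a ·ₚ p +ₚ b ·ₚ p)
  ·ₚ-distribʳ a b p = mk≋ λ i → begin
    coeff ((a + b) ·ₚ p) i           ≈⟨ coeff-·ₚ (a + b) p i ⟩
    (a + b) * coeff p i              ≈⟨ distribʳ _ _ _ ⟩
    a * coeff p i + b * coeff p i    ≈⟨ sym (trans (coeff-+ₚ (a ·ₚ p) (b ·ₚ p) i) (+-cong (coeff-·ₚ a p i) (coeff-·ₚ b p i))) ⟩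
    coeff (a ·ₚ p +ₚ b ·ₚ p) i       ∎

  ·ₚ-assoc : ∀ a b p → (a ·ₚ b ·ₚ p) ≋ ((a * b) ·ₚ p)
  ·ₚ-assoc a b p = mk≋ λ i →
    trans (coeff-·ₚ a (b ·ₚ p) i) (trans (*-congˡ (coeff-·ₚ b p i)) (trans (sym (*-assoc _ _ _)) (sym (coeff-·ₚ (a * b) p i))))

  ·ₚ-zeroˡ : ∀ p → (0# ·ₚ p) ≋ []
  ·ₚ-zeroˡ p = mk≋ (λ i → trans (coeff-·ₚ 0# p i) (zeroˡ _))

  X·-+ₚ : ∀ p r → X· (p +ₚ r) ≋ (X· p +ₚ X· r)
  X·-+ₚ p r = mk≋ λ { zero → sym (+-identityˡ 0#) ; (suc i) → refl }

  ·ₚ-X· : ∀ a p → (a ·ₚ X· p) ≋ X· (a ·ₚ p)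
  ·ₚ-X· a p = mk≋ λ { zero → zeroʳ a ; (suc i) → refl }

  +ₚ-interchange : ∀ p r s t → ((p +ₚ r) +ₚ (s +ₚ t)) ≋ ((p +ₚ s) +ₚ (r +ₚ t))
  +ₚ-interchange p r s t = mk≋ λ i → begin
    coeff ((p +ₚ r) +ₚ (s +ₚ t)) i  ≈⟨ trans (coeff-+ₚ (p +ₚ r) (s +ₚ t) i) (+-cong (coeff-+ₚ p r i) (coeff-+ₚ s t i)) ⟩
    (coeff p i + coeff r i) + (coeff s i + coeff t i)  ≈⟨ solve 4 (λ a b c d → (a :+ b) :+ (c :+ d) := (a :+ c) :+ (b :+ d)) refl _ _ _ _ ⟩
    (coeff p i + coeff s i) + (coeff r i + coeff t i)  ≈⟨ sym (trans (coeff-+ₚ (p +ₚ s) (r +ₚ t) i) (+-cong (coeff-+ₚ p s i) (coeff-+ₚ r t i))) ⟩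
    coeff ((p +ₚ s) +ₚ (r +ₚ t)) i  ∎
    where open IntegerRingSolver commRing using (solve; _:=_; _:+_)

  *ₚ-zeroˡ : ∀ p r → p ≋ [] → (p *ₚ r) ≋ []
  *ₚ-zeroˡ []      r e = ≋-refl
  *ₚ-zeroˡ (a ∷ p) r e = mk≋ λ i → begin
    coeff (a ·ₚ r +ₚ X· (p *ₚ r)) i          ≈⟨ coeff-+ₚ (a ·ₚ r) (X· (p *ₚ r)) i ⟩
    coeff (a ·ₚ r) i + coeff (X· (p *ₚ r)) i  ≈⟨ +-cong (coeff-≈ (·ₚ-cong {p = r} (coeff-≈ e zero) ≋-refl) i) (coeff-≈ (X·-zero (*ₚ-zeroˡ p r (∷-zero e))) i) ⟩
    coeff (0# ·ₚ r) i + 0#                   ≈⟨ trans (+-identityʳ _) (coeff-≈ (·ₚ-zeroˡ r) i) ⟩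
    0#                                       ∎

  *ₚ-zeroʳ : ∀ r → (r *ₚ []) ≋ []
  *ₚ-zeroʳ []      = ≋-refl
  *ₚ-zeroʳ (a ∷ r) = X·-zero (*ₚ-zeroʳ r)

  *ₚ-congʳ : ∀ {p p′} r → p ≋ p′ → (p *ₚ r) ≋ (p′ *ₚ r)
  *ₚ-congʳ {[]}    {p′}     r e = ≋-sym (*ₚ-zeroˡ p′ r (≋-sym e))
  *ₚ-congʳ {a ∷ p} {[]}     r e = *ₚ-zeroˡ (a ∷ p) r e
  *ₚ-congʳ {a ∷ p} {b ∷ p′} r e = +ₚ-cong (·ₚ-cong (coeff-≈ e zero) ≋-refl) (X·-cong (*ₚ-congʳ r (∷-injectiveʳ e)))

  *ₚ-congˡ : ∀ p {r r′} → r ≋ r′ → (p *ₚ r) ≋ (p *ₚ r′)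
  *ₚ-congˡ []      e = ≋-refl
  *ₚ-congˡ (a ∷ p) e = +ₚ-cong (·ₚ-cong refl e) (X·-cong (*ₚ-congˡ p e))

  *ₚ-cong : ∀ {p p′ r r′} → p ≋ p′ → r ≋ r′ → (p *ₚ r) ≋ (p′ *ₚ r′)
  *ₚ-cong {p} {p′} {r} e f = ≋-trans (*ₚ-congʳ r e) (*ₚ-congˡ p′ f)

  *ₚ-distribʳ : ∀ p q r → ((p +ₚ q) *ₚ r) ≋ ((p *ₚ r) +ₚ (q *ₚ r))
  *ₚ-distribʳ []      q       r = ≋-refl
  *ₚ-distribʳ (a ∷ p) []      r = ≋-sym (+ₚ-identityʳ _)
  *ₚ-distribʳ (a ∷ p) (b ∷ q) r =
    ≋-trans (+ₚ-cong (·ₚ-distribʳ a b r) (≋-trans (X·-cong (*ₚ-distribʳ p q r)) (X·-+ₚ (p *ₚ r) (q *ₚ r))))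
            (+ₚ-interchange (a ·ₚ r) (b ·ₚ r) (X· (p *ₚ r)) (X· (q *ₚ r)))

  *ₚ-distribˡ : ∀ r p q → (r *ₚ (p +ₚ q)) ≋ ((r *ₚ p) +ₚ (r *ₚ q))
  *ₚ-distribˡ []      p q = ≋-refl
  *ₚ-distribˡ (a ∷ r) p q =
    ≋-trans (+ₚ-cong (·ₚ-distribˡ a p q) (≋-trans (X·-cong (*ₚ-distribˡ r p q)) (X·-+ₚ (r *ₚ p) (r *ₚ q))))
            (+ₚ-interchange (a ·ₚ p) (a ·ₚ q) (X· (r *ₚ p)) (X· (r *ₚ q)))

  X·-*ₚ : ∀ p r → (X· p *ₚ r) ≋ X· (p *ₚ r)
  X·-*ₚ p r = +ₚ-cong (·ₚ-zeroˡ r) ≋-refl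

  ·ₚ-*ₚ : ∀ a p r → ((a ·ₚ p) *ₚ r) ≋ (a ·ₚ (p *ₚ r))
  ·ₚ-*ₚ a []      r = ≋-refl
  ·ₚ-*ₚ a (b ∷ p) r = ≋-sym (≋-trans (·ₚ-distribˡ a (b ·ₚ r) (X· (p *ₚ r)))
    (+ₚ-cong (·ₚ-assoc a b r) (≋-trans (·ₚ-X· a (p *ₚ r)) (X·-cong (≋-sym (·ₚ-*ₚ a p r))))))

  *ₚ-assoc : ∀ p r s → ((p *ₚ r) *ₚ s) ≋ (p *ₚ (r *ₚ s))
  *ₚ-assoc []      r s = ≋-refl
  *ₚ-assoc (a ∷ p) r s =
    ≋-trans (*ₚ-distribʳ (a ·ₚ r) (X· (p *ₚ r)) s)
            (+ₚ-cong (·ₚ-*ₚ a r s) (≋-trans (X·-*ₚ (p *ₚ r) s) (X·-cong (*ₚ-assoc p r s))))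

  *ₚ-∷ : ∀ p b r → (p *ₚ (b ∷ r)) ≋ (b ·ₚ p +ₚ X· (p *ₚ r))
  *ₚ-∷ []      b r = ≋-sym (X·-zero ≋-refl)
  *ₚ-∷ (a ∷ p) b r =
    ∷-cong (trans (+-identityʳ _) (trans (*-comm a b) (sym (+-identityʳ _))))
           (≋-trans (+ₚ-cong ≋-refl (*ₚ-∷ p b r)) (+ₚ-left-comm (a ·ₚ r) (b ·ₚ p) (X· (p *ₚ r))))
    where
    +ₚ-left-comm : ∀ u v w → (u +ₚ (v +ₚ w)) ≋ (v +ₚ (u +ₚ w))
    +ₚ-left-comm u v w = ≋-trans (≋-sym (+ₚ-assoc u v w)) (≋-trans (+ₚ-cong (+ₚ-comm u v) ≋-refl) (+ₚ-assoc v u w))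

  *ₚ-comm : ∀ p r → (p *ₚ r) ≋ (r *ₚ p)
  *ₚ-comm []      r = ≋-sym (*ₚ-zeroʳ r)
  *ₚ-comm (a ∷ p) r = ≋-trans (+ₚ-cong ≋-refl (X·-cong (*ₚ-comm p r))) (≋-sym (*ₚ-∷ r a p))

  *ₚ-identityˡ : ∀ p → (1ₚ *ₚ p) ≋ p
  *ₚ-identityˡ p = mk≋ λ i →
    trans (coeff-+ₚ (1# ·ₚ p) (X· []) i) (trans (+-cong (coeff-·ₚ 1# p i) (coeff-≈ (X·-zero ≋-refl) i)) (trans (+-identityʳ _) (*-identityˡ _)))

  *ₚ-identityʳ : ∀ p → (p *ₚ 1ₚ) ≋ p
  *ₚ-identityʳ p = ≋-trans (*ₚ-comm p 1ₚ) (*ₚ-identityˡ p)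

  const-*ₚ : ∀ a p → (const a *ₚ p) ≋ (a ·ₚ p)
  const-*ₚ a p = ≋-trans (+ₚ-cong ≋-refl (X·-zero ≋-refl)) (+ₚ-identityʳ (a ·ₚ p))

  const-cong : ∀ {a b} → a ≈ b → const a ≋ const b
  const-cong a≈b = ∷-cong a≈b ≋-refl

  const-*ₚ-const : ∀ a b → (const a *ₚ const b) ≋ const (a * b)
  const-*ₚ-const a b = const-*ₚ a (const b)

  const≉0 : ∀ {a} → ¬ (a ≈ 0#) → ¬ (const a ≋ [])
  const≉0 a≉0 a≈0 = a≉0 (coeff-≈ a≈0 0)

  const-zero : ∀ {a} → a ≈ 0# → const a ≋ []
  const-zero a≈0 = mk≋ λ { zero → a≈0 ; (suc i) → refl }

  coeff-sub : ∀ p q i → coeff (p -ₚ q) i ≈ coeff p i - coeff q i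
  coeff-sub p q i = trans (coeff-+ₚ p (-ₚ q) i) (+-congˡ (coeff-neg q i))

  -ₚ≋[]⇒≋ : ∀ {p r} → p -ₚ r ≋ [] → p ≋ r
  -ₚ≋[]⇒≋ {p} {r} p-r≈0 = mk≋ λ i → x∙y⁻¹≈ε⇒x≈y _ _ (trans (sym (coeff-sub p r i)) (coeff-≈ p-r≈0 i))
    where open import Algebra.Properties.Group +-group using (x∙y⁻¹≈ε⇒x≈y)

  polynomialRing : CommutativeRing c ℓ
  polynomialRing = record
    { Carrier = Pol
    ; _≈_ = _≋_
    ; _+_ = _+ₚ_
    ; _*_ = _*ₚ_
    ; -_ = -ₚ_
    ; 0# = []
    ; 1# = 1ₚ
    ; isCommutativeRing = record
      { isRing = record
        { +-isAbelianGroup = record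
          { isGroup = record
            { isMonoid = record
              { isSemigroup = record
                { isMagma = record
                  { isEquivalence = record { refl = ≋-refl ; sym = ≋-sym ; trans = ≋-trans }
                  ; ∙-cong = +ₚ-cong }
                ; assoc = +ₚ-assoc }
              ; identity = (λ p → ≋-refl) , +ₚ-identityʳ }
            ; inverse = -ₚ-inverseˡ , -ₚ-inverseʳ
            ; ⁻¹-cong = -ₚ-cong }
          ; comm = +ₚ-comm }
        ; *-cong = *ₚ-cong
        ; *-assoc = *ₚ-assoc
        ; *-identity = *ₚ-identityˡ , *ₚ-identityʳ
        ; distrib = *ₚ-distribˡ , (λ p q r → *ₚ-distribʳ q r p) }
      ; *-comm = *ₚ-comm } }

  -1ₚ : Pol
  -1ₚ = -ₚ 1ₚ

module EnumerationProducts {c ℓ} (M : CommutativeMonoid c ℓ) where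
  open CommutativeMonoid M
  open import Relation.Binary.Reasoning.Setoid setoid

  ∏ : List Carrier → Carrier
  ∏ = foldr _∙_ ε

  Distinct : List Carrier → Set (c ⊔ ℓ)
  Distinct = AllPairs (λ x y → ¬ (x ≈ y))

  Enumerates : ∀ {s} → (Carrier → Set s) → List Carrier → Set (c ⊔ ℓ ⊔ s)
  Enumerates S L = All S L × (∀ g → S g → Any (g ≈_) L) × Distinct L

  module _ {q} {Q : Carrier → Set q} where

    ∏-─ : ∀ xs (p : Any Q xs) → ∏ xs ≈ Any.lookup p ∙ ∏ (xs ─ p)
    ∏-─ (x ∷ xs) (here _)  = refl
    ∏-─ (x ∷ xs) (there p) = begin
      x ∙ ∏ xs                                   ≈⟨ ∙-congˡ (∏-─ xs p) ⟩
      x ∙ (Any.lookup p ∙ ∏ (xs ─ p))            ≈⟨ sym (assoc _ _ _) ⟩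
      (x ∙ Any.lookup p) ∙ ∏ (xs ─ p)            ≈⟨ ∙-congʳ (comm _ _) ⟩
      (Any.lookup p ∙ x) ∙ ∏ (xs ─ p)            ≈⟨ assoc _ _ _ ⟩
      Any.lookup p ∙ (x ∙ ∏ (xs ─ p))            ∎

    ─-≉-lookup : ∀ {xs} → Distinct xs → (p : Any Q xs) → All (λ z → ¬ (z ≈ Any.lookup p)) (xs ─ p)
    ─-≉-lookup (h ∷ d) (here _)  = All.map (λ x≉y y≈x → x≉y (sym y≈x)) h
    ─-≉-lookup (h ∷ d) (there p) = proj₁ (All.lookupAny h p) ∷ ─-≉-lookup d p

    Distinct-─ : ∀ {xs} → Distinct xs → (p : Any Q xs) → Distinct (xs ─ p)
    Distinct-─ (_ ∷ d) (here _)  = d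
    Distinct-─ (h ∷ d) (there p) = Allₚ.─⁺ p h ∷ Distinct-─ d p

    Any-─ : ∀ {q′} {Q′ : Carrier → Set q′} {xs} (p : Any Q xs) → Any Q′ xs → Q′ (Any.lookup p) ⊎ Any Q′ (xs ─ p)
    Any-─ (here _)  (here q)  = inj₁ q
    Any-─ (here _)  (there a) = inj₂ a
    Any-─ (there p) (here q)  = inj₂ (here q)
    Any-─ (there p) (there a) with Any-─ p a
    ... | inj₁ q = inj₁ q
    ... | inj₂ b = inj₂ (there b)

    ─-Any : ∀ {q′} {Q′ : Carrier → Set q′} xs (p : Any Q xs) → Any Q′ (xs ─ p) → Any Q′ xs
    ─-Any (x ∷ xs) (here _)  a         = there a
    ─-Any (x ∷ xs) (there p) (here e)  = here e
    ─-Any (x ∷ xs) (there p) (there a) = there (─-Any xs p a)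

  ∏-∷-─ : ∀ {x xs} (p : Any (λ y → x ∙ y ≈ ε) xs) → ∏ (x ∷ xs) ≈ ∏ (xs ─ p)
  ∏-∷-─ {x} {xs} p = begin
    x ∙ ∏ xs                           ≈⟨ ∙-congˡ (∏-─ xs p) ⟩
    x ∙ (Any.lookup p ∙ ∏ (xs ─ p))    ≈⟨ sym (assoc _ _ _) ⟩
    (x ∙ Any.lookup p) ∙ ∏ (xs ─ p)    ≈⟨ ∙-congʳ (Anyₚ.lookup-result p) ⟩
    ε ∙ ∏ (xs ─ p)                     ≈⟨ identityˡ _ ⟩
    ∏ (xs ─ p)                         ∎

  ∏-unique : ∀ {s} {S : Carrier → Set s} L₁ L₂ → Enumerates S L₁ → Enumerates S L₂ → ∏ L₁ ≈ ∏ L₂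
  ∏-unique [] [] _ _ = refl
  ∏-unique [] (y ∷ L₂) (_ , complete₁ , _) (sy ∷ _ , _) with complete₁ y sy
  ... | ()
  ∏-unique {S = S} (x ∷ L₁) L₂ (sx ∷ all₁ , complete₁ , h₁ ∷ distinct₁) (all₂ , complete₂ , distinct₂) = begin
    x ∙ ∏ L₁                   ≈⟨ ∙-cong x≈y (∏-unique L₁ (L₂ ─ p) enum₁ enum₂) ⟩
    Any.lookup p ∙ ∏ (L₂ ─ p)  ≈⟨ sym (∏-─ L₂ p) ⟩
    ∏ L₂                       ∎
    where
    p : Any (x ≈_) L₂
    p = complete₂ x sx
    x≈y : x ≈ Any.lookup p
    x≈y = Anyₚ.lookup-result p
    S′ : Carrier → Set _
    S′ g = S g × ¬ (g ≈ x)
    enum₁ : Enumerates S′ L₁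
    enum₁ = All.zipWith (λ (s , x≉g) → s , (λ g≈x → x≉g (sym g≈x))) (all₁ , h₁)
          , (λ g (sg , g≉x) → drop g≉x (complete₁ g sg)) , distinct₁
      where
      drop : ∀ {g} → ¬ (g ≈ x) → Any (g ≈_) (x ∷ L₁) → Any (g ≈_) L₁
      drop g≉x (here g≈x) = ⊥-elim (g≉x g≈x)
      drop g≉x (there a)  = a
    enum₂ : Enumerates S′ (L₂ ─ p)
    enum₂ = All.zipWith (λ (s , g≉y) → s , (λ g≈x → g≉y (trans g≈x x≈y))) (Allₚ.─⁺ p all₂ , ─-≉-lookup distinct₂ p)
          , (λ g (sg , g≉x) → drop g≉x (Any-─ p (complete₂ g sg))) , Distinct-─ distinct₂ p
      where
      drop : ∀ {g} → ¬ (g ≈ x) → (g ≈ Any.lookup p) ⊎ Any (g ≈_) (L₂ ─ p) → Any (g ≈_) (L₂ ─ p)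
      drop g≉x (inj₁ g≈y) = ⊥-elim (g≉x (trans g≈y (sym x≈y)))
      drop g≉x (inj₂ a)   = a

  Enumerates-resp-⇔ : ∀ {s t} {S : Carrier → Set s} {T : Carrier → Set t} {L} →
                      (∀ g → S g → T g) → (∀ g → T g → S g) → Enumerates S L → Enumerates T L
  Enumerates-resp-⇔ S⇒T T⇒S (all , complete , distinct) = All.map (S⇒T _) all , (λ g tg → complete g (T⇒S g tg)) , distinct

  module _ {q} {Q : Carrier → Set q} (Q? : Unary.Decidable Q) where

    ∏-partition : ∀ xs → ∏ xs ≈ ∏ (filter Q? xs) ∙ ∏ (filter (∁? Q?) xs)
    ∏-partition []       = sym (identityˡ ε)
    ∏-partition (x ∷ xs) with Q? x
    ... | yes _ = begin
      x ∙ ∏ xs                                        ≈⟨ ∙-congˡ (∏-partition xs) ⟩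
      x ∙ (∏ (filter Q? xs) ∙ ∏ (filter (∁? Q?) xs))  ≈⟨ sym (assoc _ _ _) ⟩
      (x ∙ ∏ (filter Q? xs)) ∙ ∏ (filter (∁? Q?) xs)  ∎
    ... | no _ = begin
      x ∙ ∏ xs                                        ≈⟨ ∙-congˡ (∏-partition xs) ⟩
      x ∙ (∏ (filter Q? xs) ∙ ∏ (filter (∁? Q?) xs))  ≈⟨ x∙yz≈y∙xz _ _ _ ⟩
      ∏ (filter Q? xs) ∙ (x ∙ ∏ (filter (∁? Q?) xs))  ∎
      where open import Algebra.Properties.CommutativeSemigroup commutativeSemigroup using (x∙yz≈y∙xz)

    Enumerates-filter : (∀ {x y} → x ≈ y → Q x → Q y) →
                        ∀ {s} {S : Carrier → Set s} L → Enumerates S L → Enumerates (λ g → S g × Q g) (filter Q? L)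
    Enumerates-filter Q-resp {S = S} L (all , complete , distinct) =
      all-filter L all , (λ g (sg , qg) → any-filter L qg (complete g sg)) , AllPairsₚ.filter⁺ Q? distinct
      where
      all-filter : ∀ L → All S L → All (λ g → S g × Q g) (filter Q? L)
      all-filter []      []         = []
      all-filter (x ∷ L) (sx ∷ all) with Q? x
      ... | yes qx = (sx , qx) ∷ all-filter L all
      ... | no _   = all-filter L all
      any-filter : ∀ L {g} → Q g → Any (g ≈_) L → Any (g ≈_) (filter Q? L)
      any-filter (x ∷ L) qg a with Q? x
      any-filter (x ∷ L) qg (here e)  | yes _  = here e
      any-filter (x ∷ L) qg (there a) | yes _  = there (any-filter L qg a)
      any-filter (x ∷ L) qg (here e)  | no ¬qx = ⊥-elim (¬qx (Q-resp e qg))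
      any-filter (x ∷ L) qg (there a) | no _   = any-filter L qg a

  inverse-unique : ∀ {x y z} → x ∙ y ≈ ε → x ∙ z ≈ ε → y ≈ z
  inverse-unique {x} {y} {z} xy≈ε xz≈ε = begin
    y            ≈⟨ sym (identityʳ y) ⟩
    y ∙ ε        ≈⟨ ∙-congˡ (sym xz≈ε) ⟩
    y ∙ (x ∙ z)  ≈⟨ sym (assoc _ _ _) ⟩
    (y ∙ x) ∙ z  ≈⟨ ∙-congʳ (trans (comm y x) xy≈ε) ⟩
    ε ∙ z        ≈⟨ identityˡ z ⟩
    z            ∎

  HasInverseIn : List Carrier → Carrier → Set (c ⊔ ℓ)
  HasInverseIn L x = Any (λ y → x ∙ y ≈ ε) L

  InverseClosed : List Carrier → Set (c ⊔ ℓ)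
  InverseClosed L = All (HasInverseIn L) L

  -- Wilson's theorem: in an inverse-closed list, the elements other than
  -- the square roots of ε cancel in pairs.
  module Wilson (m : Carrier) (m∙m≈ε : m ∙ m ≈ ε) (_≟_ : ∀ x y → Dec (x ≈ y)) where

    SquareRootsOfε⊆ : List Carrier → Set (c ⊔ ℓ)
    SquareRootsOfε⊆ L = All (λ x → x ∙ x ≈ ε → x ≈ ε ⊎ x ≈ m) L

    WilsonProduct : List Carrier → Set (c ⊔ ℓ)
    WilsonProduct L = (Any (_≈ m) L × ∏ L ≈ m) ⊎ (¬ Any (_≈ m) L × ∏ L ≈ ε)

    private
      dropSelfInverse : ∀ {x T} → x ∙ x ≈ ε → All (λ z → ¬ (x ≈ z)) T →
                        All (HasInverseIn (x ∷ T)) T → InverseClosed T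
      dropSelfInverse xx≈ε x∉T invs = All.zipWith drop (invs , x∉T)
        where
        drop : ∀ {z} → HasInverseIn (_ ∷ _) z × ¬ (_ ≈ z) → HasInverseIn _ z
        drop (here zx≈ε , x≉z) = ⊥-elim (x≉z (inverse-unique xx≈ε (trans (comm _ _) zx≈ε)))
        drop (there a   , _)   = a

      dropPair : ∀ {x T} (p : HasInverseIn T x) → All (λ z → ¬ (x ≈ z)) T → Distinct T →
                 All (HasInverseIn (x ∷ T)) T → InverseClosed (T ─ p)
      dropPair {x} {T} p x∉T distinct invs =
        All.zipWith drop (Allₚ.─⁺ p (All.zipWith (λ z → z) (invs , x∉T)) , ─-≉-lookup distinct p)
        where
        xy≈ε : x ∙ Any.lookup p ≈ ε
        xy≈ε = Anyₚ.lookup-result p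
        drop : ∀ {z} → (HasInverseIn (x ∷ T) z × ¬ (x ≈ z)) × ¬ (z ≈ Any.lookup p) → HasInverseIn (T ─ p) z
        drop ((here zx≈ε , _) , z≉y) = ⊥-elim (z≉y (inverse-unique (trans (comm _ _) zx≈ε) xy≈ε))
        drop ((there a , x≉z) , _) with Any-─ p a
        ... | inj₁ zy≈ε = ⊥-elim (x≉z (inverse-unique (trans (comm _ _) xy≈ε) (trans (comm _ _) zy≈ε)))
        ... | inj₂ b    = b

      x≈m⇒m∉ : ∀ {x T} → x ≈ m → All (λ z → ¬ (x ≈ z)) T → ¬ Any (_≈ m) T
      x≈m⇒m∉ x≈m (x≉z ∷ _) (here z≈m) = x≉z (trans x≈m (sym z≈m))
      x≈m⇒m∉ x≈m (_ ∷ x∉T) (there a)  = x≈m⇒m∉ x≈m x∉T a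

      ∏-∷-selfInverse : ∀ {x T} → All (λ z → ¬ (x ≈ z)) T → x ≈ ε ⊎ x ≈ m → WilsonProduct T → WilsonProduct (x ∷ T)
      ∏-∷-selfInverse x∉T (inj₁ x≈ε) (inj₁ (m∈T , ∏T≈m)) =
        inj₁ (there m∈T , trans (∙-congʳ x≈ε) (trans (identityˡ _) ∏T≈m))
      ∏-∷-selfInverse {x} x∉T (inj₁ x≈ε) (inj₂ (m∉T , ∏T≈ε)) with x ≟ m
      ... | yes x≈m = inj₁ (here x≈m , trans (∙-congʳ x≈ε) (trans (identityˡ _) (trans ∏T≈ε (trans (sym x≈ε) x≈m))))
      ... | no  x≉m = inj₂ ((λ { (here x≈m) → x≉m x≈m ; (there m∈T) → m∉T m∈T })
                           , trans (∙-congʳ x≈ε) (trans (identityˡ _) ∏T≈ε))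
      ∏-∷-selfInverse x∉T (inj₂ x≈m) (inj₁ (m∈T , _))    = ⊥-elim (x≈m⇒m∉ x≈m x∉T m∈T)
      ∏-∷-selfInverse x∉T (inj₂ x≈m) (inj₂ (_ , ∏T≈ε))  = inj₁ (here x≈m , trans (∙-cong x≈m ∏T≈ε) (identityʳ m))

      ∏-∷-pair : ∀ {x T} (p : HasInverseIn T x) → All (λ z → ¬ (x ≈ z)) T → WilsonProduct (T ─ p) → WilsonProduct (x ∷ T)
      ∏-∷-pair {x} {T} p x∉T (inj₁ (m∈ , ∏≈m)) = inj₁ (there (─-Any T p m∈) , trans (∏-∷-─ p) ∏≈m)
      ∏-∷-pair {x} {T} p x∉T (inj₂ (m∉ , ∏≈ε)) = inj₂ ((λ m∈ → m∉ (m∈-─ m∈)) , trans (∏-∷-─ p) ∏≈ε)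
        where
        xy≈ε : x ∙ Any.lookup p ≈ ε
        xy≈ε = Anyₚ.lookup-result p
        x≉m : ¬ (x ≈ m)
        x≉m x≈m = proj₁ (All.lookupAny x∉T p) (trans x≈m (inverse-unique m∙m≈ε (trans (∙-congʳ (sym x≈m)) xy≈ε)))
        y≉m : ¬ (Any.lookup p ≈ m)
        y≉m y≈m = x≉m (inverse-unique (trans (comm m x) (trans (∙-congˡ (sym y≈m)) xy≈ε)) m∙m≈ε)
        m∈-─ : Any (_≈ m) (x ∷ T) → Any (_≈ m) (T ─ p)
        m∈-─ (here x≈m) = ⊥-elim (x≉m x≈m)
        m∈-─ (there a) with Any-─ p a
        ... | inj₁ y≈m = ⊥-elim (y≉m y≈m)
        ... | inj₂ b   = b

    ∏-inverseClosed : ∀ n L → length L ≤ n → Distinct L → InverseClosed L → SquareRootsOfε⊆ L → WilsonProduct L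
    ∏-inverseClosed n [] _ _ _ _ = inj₂ ((λ ()) , refl)
    ∏-inverseClosed (suc n) (x ∷ T) (s≤s |T|≤n) (x∉T ∷ distinct) (x-inverse ∷ invs) (rootₓ ∷ roots) with x-inverse
    ... | here xx≈ε = ∏-∷-selfInverse x∉T (rootₓ xx≈ε)
                        (∏-inverseClosed n T |T|≤n distinct (dropSelfInverse xx≈ε x∉T invs) roots)
    ... | there p   = ∏-∷-pair p x∉T
                        (∏-inverseClosed n (T ─ p) |T─p|≤n (Distinct-─ distinct p) (dropPair p x∉T distinct invs) (Allₚ.─⁺ p roots))
      where
      |T─p|≤n : length (T ─ p) ≤ n
      |T─p|≤n = ℕ.≤-trans (ℕ.n≤1+n _) (ℕ.≤-trans (ℕ.≤-reflexive (≡.sym (Listₚ.length-removeAt′ T (Any.index p)))) |T|≤n)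

  module SignOfLength (m : Carrier) (m∙m≈ε : m ∙ m ≈ ε) where

    m^length : ∀ {a} {A : Set a} → List A → Carrier
    m^length []       = ε
    m^length (_ ∷ xs) = m ∙ m^length xs

    m^length-++ : ∀ {a} {A : Set a} (xs ys : List A) → m^length (xs ++ ys) ≈ m^length xs ∙ m^length ys
    m^length-++ []       ys = sym (identityˡ _)
    m^length-++ (x ∷ xs) ys = trans (∙-congˡ (m^length-++ xs ys)) (sym (assoc _ _ _))

    m^length-map : ∀ {a b} {A : Set a} {B : Set b} (f : A → B) xs → m^length (map f xs) ≡ m^length xs
    m^length-map f []       = ≡.refl
    m^length-map f (x ∷ xs) = ≡.cong (m ∙_) (m^length-map f xs)

    m^length-cartesianProductWith : ∀ {a b d} {A : Set a} {B : Set b} {D : Set d} (f : A → B → D) xs ys →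
                                    m^length ys ≈ m → m^length (List.cartesianProductWith f xs ys) ≈ m^length xs
    m^length-cartesianProductWith f []       ys _    = refl
    m^length-cartesianProductWith f (x ∷ xs) ys ys≈m = begin
      m^length (map (f x) ys ++ List.cartesianProductWith f xs ys)          ≈⟨ m^length-++ (map (f x) ys) _ ⟩
      m^length (map (f x) ys) ∙ m^length (List.cartesianProductWith f xs ys) ≈⟨ ∙-cong (reflexive (m^length-map (f x) ys)) (m^length-cartesianProductWith f xs ys ys≈m) ⟩
      m^length ys ∙ m^length xs                                             ≈⟨ ∙-congʳ ys≈m ⟩
      m ∙ m^length xs                                                       ∎

    m^length-odd : ∀ {a} {A : Set a} (xs : List A) → ¬ (length xs % 2 ≡ 0) → m^length xs ≈ m
    m^length-odd []           even = ⊥-elim (even ≡.refl)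
    m^length-odd (_ ∷ [])     _    = identityʳ m
    m^length-odd (_ ∷ _ ∷ xs) odd  = begin
      m ∙ (m ∙ m^length xs)  ≈⟨ sym (assoc _ _ _) ⟩
      (m ∙ m) ∙ m^length xs  ≈⟨ ∙-congʳ m∙m≈ε ⟩
      ε ∙ m^length xs        ≈⟨ identityˡ _ ⟩
      m^length xs            ≈⟨ m^length-odd xs odd ⟩
      m                      ∎

module FieldInverse {c ℓ} (F : FiniteField c ℓ) where
  open FiniteField F hiding (zero)
  open import Relation.Binary.Reasoning.Setoid setoid

  inv : ∀ x → ¬ (x ≈ 0#) → Carrier
  inv x x≉0 = proj₁ (inverse x x≉0)

  *-inverseʳ : ∀ x (x≉0 : ¬ (x ≈ 0#)) → x * inv x x≉0 ≈ 1#
  *-inverseʳ x x≉0 = proj₂ (inverse x x≉0)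

  *-inverseˡ : ∀ x (x≉0 : ¬ (x ≈ 0#)) → inv x x≉0 * x ≈ 1#
  *-inverseˡ x x≉0 = trans (*-comm _ _) (*-inverseʳ x x≉0)

  *-nonzero : ∀ {a b} → ¬ (a ≈ 0#) → ¬ (b ≈ 0#) → ¬ (a * b ≈ 0#)
  *-nonzero {a} {b} a≉0 b≉0 ab≈0 = b≉0 (begin
    b                      ≈⟨ sym (*-identityˡ b) ⟩
    1# * b                 ≈⟨ *-congʳ (sym (*-inverseˡ a a≉0)) ⟩
    (inv a a≉0 * a) * b    ≈⟨ *-assoc _ _ _ ⟩
    inv a a≉0 * (a * b)    ≈⟨ *-congˡ ab≈0 ⟩
    inv a a≉0 * 0#         ≈⟨ zeroʳ _ ⟩
    0#                     ∎)

module Degree {c ℓ} (F : FiniteField c ℓ) where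
  open FiniteField F hiding (zero)
  open Poly F
  open PolynomialRing F
  open FieldInverse F
  open import Algebra.Properties.Ring ring using (-0#≈0#)

  DegreeBelow : ℕ → Pol → Set ℓ
  DegreeBelow n p = ∀ i → n ≤ i → coeff p i ≈ 0#

  All≈0⇒≋[] : ∀ {p} → All (_≈ 0#) p → p ≋ []
  All≈0⇒≋[] []          = ≋-refl
  All≈0⇒≋[] (a≈0 ∷ p≈0) = mk≋ λ { zero → a≈0 ; (suc i) → coeff-≈ (All≈0⇒≋[] p≈0) i }

  ≋[]⇒All≈0 : ∀ {p} → p ≋ [] → All (_≈ 0#) p
  ≋[]⇒All≈0 {[]}    _   = []
  ≋[]⇒All≈0 {a ∷ p} p≈0 = coeff-≈ p≈0 zero ∷ ≋[]⇒All≈0 (∷-zero p≈0)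

  ≋[]? : (p : Pol) → Dec (p ≋ [])
  ≋[]? p with isZero? p
  ... | yes p≈0 = yes (All≈0⇒≋[] p≈0)
  ... | no  p≉0 = no (λ p≈0 → p≉0 (≋[]⇒All≈0 p≈0))

  degreeBelow-0 : ∀ {p} → DegreeBelow 0 p → p ≋ []
  degreeBelow-0 below = mk≋ (λ i → below i z≤n)

  degreeBelow-mono : ∀ {m n p} → m ≤ n → DegreeBelow m p → DegreeBelow n p
  degreeBelow-mono m≤n below i n≤i = below i (ℕ.≤-trans m≤n n≤i)

  degreeBelow-cong : ∀ {n p r} → p ≋ r → DegreeBelow n p → DegreeBelow n r
  degreeBelow-cong p≋r below i n≤i = trans (sym (coeff-≈ p≋r i)) (below i n≤i)

  degreeBelow-1+deg : ∀ p → DegreeBelow (suc (deg p)) p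
  degreeBelow-1+deg []      i       _ = refl
  degreeBelow-1+deg (a ∷ p) i       _ with isZero? p
  degreeBelow-1+deg (a ∷ p) (suc i) _         | yes p≈0 = coeff-≈ (All≈0⇒≋[] p≈0) i
  degreeBelow-1+deg (a ∷ p) (suc i) (s≤s le)  | no _    = degreeBelow-1+deg p i le

  deg-zero : ∀ p → p ≋ [] → deg p ≡ 0
  deg-zero []      _ = ≡.refl
  deg-zero (a ∷ p) p≈0 with isZero? p
  ... | yes _   = ≡.refl
  ... | no  p≉0 = ⊥-elim (p≉0 (≋[]⇒All≈0 (∷-zero p≈0)))

  lead≉0 : ∀ p → ¬ (p ≋ []) → ¬ (lead p ≈ 0#)
  lead≉0 []      p≉0 _ = p≉0 ≋-refl
  lead≉0 (a ∷ p) p≉0 lead≈0 with isZero? p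
  ... | yes p≈0 = p≉0 (All≈0⇒≋[] (lead≈0 ∷ p≈0))
  ... | no  p≉0′ = lead≉0 p (λ p≈0 → p≉0′ (≋[]⇒All≈0 p≈0)) lead≈0

  deg-exact : ∀ p n → ¬ (coeff p n ≈ 0#) → DegreeBelow (suc n) p → deg p ≡ n
  deg-exact []      n       cₙ≉0 _ = ⊥-elim (cₙ≉0 refl)
  deg-exact (a ∷ p) n       cₙ≉0 below with isZero? p
  deg-exact (a ∷ p) zero    cₙ≉0 below | yes _   = ≡.refl
  deg-exact (a ∷ p) (suc n) cₙ≉0 below | yes p≈0 = ⊥-elim (cₙ≉0 (coeff-≈ (All≈0⇒≋[] p≈0) n))
  deg-exact (a ∷ p) zero    cₙ≉0 below | no  p≉0 = ⊥-elim (p≉0 (≋[]⇒All≈0 (mk≋ (λ i → below (suc i) (s≤s z≤n)))))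
  deg-exact (a ∷ p) (suc n) cₙ≉0 below | no  _   = ≡.cong suc (deg-exact p n cₙ≉0 (λ i le → below (suc i) (s≤s le)))

  degreeBelow⇒deg≤ : ∀ p n → DegreeBelow (suc n) p → deg p ≤ n
  degreeBelow⇒deg≤ p n below with ≋[]? p
  ... | yes p≈0 rewrite deg-zero p p≈0 = z≤n
  ... | no  p≉0 with ℕ.≤-<-connex (deg p) n
  ...   | inj₁ le = le
  ...   | inj₂ lt = ⊥-elim (lead≉0 p p≉0 (below (deg p) lt))

  deg-cong : ∀ {p r} → p ≋ r → deg p ≡ deg r
  deg-cong {p} {r} p≋r with ≋[]? p
  ... | yes p≈0 = ≡.trans (deg-zero p p≈0) (≡.sym (deg-zero r (≋-trans (≋-sym p≋r) p≈0)))
  ... | no  p≉0 = ≡.sym (deg-exact r (deg p) (λ z → lead≉0 p p≉0 (trans (coeff-≈ p≋r (deg p)) z))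
                                     (degreeBelow-cong p≋r (degreeBelow-1+deg p)))

  lead-cong : ∀ {p r} → p ≋ r → lead p ≈ lead r
  lead-cong {p} {r} p≋r rewrite deg-cong p≋r = coeff-≈ p≋r (deg r)

  deg≡0⇒const : ∀ p → deg p ≡ 0 → p ≋ const (coeff p 0)
  deg≡0⇒const p deg≡0 = mk≋ λ where
    zero    → refl
    (suc i) → degreeBelow-1+deg p (suc i) (s≤s (≡.subst (_≤ i) (≡.sym deg≡0) z≤n))

  degreeBelow-sub : ∀ {n p q} → DegreeBelow n p → DegreeBelow n q → DegreeBelow n (p -ₚ q)
  degreeBelow-sub {p = p} {q} bp bq i le =
    trans (coeff-sub p q i) (trans (+-cong (bp i le) (-‿cong (bq i le))) (trans (+-congˡ -0#≈0#) (+-identityʳ 0#)))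

  monic⇒≉0 : ∀ {b} → Monic b → ¬ (b ≋ [])
  monic⇒≉0 {b} monic b≈0 = 1≉0 (trans (sym monic) (coeff-≈ b≈0 (deg b)))

  *ₚ-top : ∀ p r m n → DegreeBelow (suc m) p → DegreeBelow (suc n) r →
           DegreeBelow (suc (m ℕ.+ n)) (p *ₚ r) × (coeff (p *ₚ r) (m ℕ.+ n) ≈ coeff p m * coeff r n)
  *ₚ-top []      r m       n _  _  = (λ i _ → refl) , sym (zeroˡ _)
  *ₚ-top (a ∷ p) r zero    n bp br = below , top
    where
    a·r : ((a ∷ p) *ₚ r) ≋ (a ·ₚ r)
    a·r = ≋-trans (+ₚ-cong ≋-refl (X·-zero (*ₚ-zeroˡ p r (mk≋ (λ i → bp (suc i) (s≤s z≤n)))))) (+ₚ-identityʳ _)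
    below : DegreeBelow (suc n) ((a ∷ p) *ₚ r)
    below i le = trans (coeff-≈ a·r i) (trans (coeff-·ₚ a r i) (trans (*-congˡ (br i le)) (zeroʳ a)))
    top : coeff ((a ∷ p) *ₚ r) n ≈ a * coeff r n
    top = trans (coeff-≈ a·r n) (coeff-·ₚ a r n)
  *ₚ-top (a ∷ p) r (suc m) n bp br = below , top
    where
    ih = *ₚ-top p r m n (λ i le → bp (suc i) (s≤s le)) br
    coeff-∷-*ₚ : ∀ i → coeff ((a ∷ p) *ₚ r) i ≈ a * coeff r i + coeff (X· (p *ₚ r)) i
    coeff-∷-*ₚ i = trans (coeff-+ₚ (a ·ₚ r) (X· (p *ₚ r)) i) (+-congʳ (coeff-·ₚ a r i))
    a·r-vanishes : ∀ i → suc (m ℕ.+ n) ≤ i → a * coeff r i ≈ 0#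
    a·r-vanishes i le = trans (*-congˡ (br i (ℕ.≤-trans (s≤s (ℕ.m≤n+m n m)) le))) (zeroʳ a)
    below : DegreeBelow (suc (suc m ℕ.+ n)) ((a ∷ p) *ₚ r)
    below (suc i) (s≤s le) =
      trans (coeff-∷-*ₚ (suc i)) (trans (+-cong (a·r-vanishes (suc i) (ℕ.≤-trans (ℕ.n≤1+n _) (s≤s le))) (proj₁ ih i le)) (+-identityˡ _))
    top : coeff ((a ∷ p) *ₚ r) (suc m ℕ.+ n) ≈ coeff p m * coeff r n
    top = trans (coeff-∷-*ₚ (suc (m ℕ.+ n))) (trans (+-cong (a·r-vanishes _ ℕ.≤-refl) (proj₂ ih)) (+-identityˡ _))

  module _ (p r : Pol) (p≉0 : ¬ (p ≋ [])) (r≉0 : ¬ (r ≋ [])) where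
    private
      top : DegreeBelow (suc (deg p ℕ.+ deg r)) (p *ₚ r) × (coeff (p *ₚ r) (deg p ℕ.+ deg r) ≈ lead p * lead r)
      top = *ₚ-top p r (deg p) (deg r) (degreeBelow-1+deg p) (degreeBelow-1+deg r)
      top≉0 : ¬ (coeff (p *ₚ r) (deg p ℕ.+ deg r) ≈ 0#)
      top≉0 z = *-nonzero (lead≉0 p p≉0) (lead≉0 r r≉0) (trans (sym (proj₂ top)) z)

    deg-*ₚ : deg (p *ₚ r) ≡ deg p ℕ.+ deg r
    deg-*ₚ = deg-exact (p *ₚ r) _ top≉0 (proj₁ top)

    lead-*ₚ : lead (p *ₚ r) ≈ lead p * lead r
    lead-*ₚ rewrite deg-*ₚ = proj₂ top

module Division {c ℓ} (F : FiniteField c ℓ) where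
  open FiniteField F hiding (zero)
  open Poly F
  open PolynomialRing F
  open FieldInverse F
  open Degree F
  open IntegerRingSolver polynomialRing using (solve; _:=_; _:+_; _:*_; _:-_)

  X : Pol
  X = 0# ∷ 1ₚ

  X*ₚ : ∀ p → (X *ₚ p) ≋ X· p
  X*ₚ p = +ₚ-cong (·ₚ-zeroˡ p) (X·-cong (*ₚ-identityˡ p))

  ∷≋const+X*ₚ : ∀ a p → (a ∷ p) ≋ (const a +ₚ X *ₚ p)
  ∷≋const+X*ₚ a p = ≋-sym (≋-trans (+ₚ-cong (≋-refl {const a}) (X*ₚ p)) (∷-cong (+-identityʳ a) ≋-refl))

  record DivisionWithRemainder (b g : Pol) : Set (c ⊔ ℓ) where
    constructor mkDivision
    field
      quotient  : Pol
      remainder : Pol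
      division  : g ≋ (b *ₚ quotient) +ₚ remainder
      remainder-small : DegreeBelow (deg b) remainder
  open DivisionWithRemainder public

  divideByMonic : ∀ b → Monic b → ∀ g → DivisionWithRemainder b g
  divideByMonic b monic []      = mkDivision [] [] (≋-sym (≋-trans (+ₚ-identityʳ _) (*ₚ-zeroʳ b))) (λ i _ → refl)
  divideByMonic b monic (a ∷ g) = mkDivision (X *ₚ h +ₚ const cₙ) r division′ small
    where
    ih = divideByMonic b monic g
    h  = quotient ih
    s  = a ∷ remainder ih
    cₙ = coeff s (deg b)
    r  = s -ₚ (const cₙ *ₚ b)
    division′ : (a ∷ g) ≋ (b *ₚ (X *ₚ h +ₚ const cₙ)) +ₚ r
    division′ =
      ≋-trans (∷≋const+X*ₚ a g)
      (≋-trans (+ₚ-cong (≋-refl {const a}) (*ₚ-congˡ X (division ih)))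
      (≋-trans (solve 6 (λ A B H R C Y → A :+ Y :* (B :* H :+ R) := (B :* (Y :* H :+ C)) :+ ((A :+ Y :* R) :- (C :* B)))
                        ≋-refl (const a) b h (remainder ih) (const cₙ) X)
               (+ₚ-cong (≋-refl {b *ₚ (X *ₚ h +ₚ const cₙ)}) (+ₚ-cong (≋-sym (∷≋const+X*ₚ a (remainder ih))) (≋-refl { -ₚ (const cₙ *ₚ b)})))))
    s-small : DegreeBelow (suc (deg b)) s
    s-small (suc i) (s≤s le) = remainder-small ih i le
    cₙb : ∀ i → coeff (const cₙ *ₚ b) i ≈ cₙ * coeff b i
    cₙb i = trans (coeff-≈ (const-*ₚ cₙ b) i) (coeff-·ₚ cₙ b i)
    small : DegreeBelow (deg b) r
    small i le with ℕ.m≤n⇒m<n∨m≡n le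
    ... | inj₂ ≡.refl = trans (coeff-sub s (const cₙ *ₚ b) i)
                              (trans (+-congˡ (-‿cong (trans (cₙb i) (trans (*-congˡ monic) (*-identityʳ cₙ))))) (-‿inverseʳ cₙ))
    ... | inj₁ lt = degreeBelow-sub {p = s} {q = const cₙ *ₚ b} s-small
                      (λ j le′ → trans (cₙb j) (trans (*-congˡ (degreeBelow-1+deg b j le′)) (zeroʳ cₙ))) i lt

  monic-*ₚ-small : ∀ b u → Monic b → DegreeBelow (deg b) (b *ₚ u) → u ≋ []
  monic-*ₚ-small b u monic small with ≋[]? u
  ... | yes u≈0 = u≈0
  ... | no  u≉0 = ⊥-elim (lead≉0 u u≉0 (trans (sym lead-bu≈lead-u) (small _ deg-b≤deg-bu)))
    where
    lead-bu≈lead-u : lead (b *ₚ u) ≈ lead u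
    lead-bu≈lead-u = trans (lead-*ₚ b u (monic⇒≉0 monic) u≉0) (trans (*-congʳ monic) (*-identityˡ _))
    deg-b≤deg-bu : deg b ≤ deg (b *ₚ u)
    deg-b≤deg-bu rewrite deg-*ₚ b u (monic⇒≉0 monic) u≉0 = ℕ.m≤m+n (deg b) (deg u)

  division-unique : ∀ b h h′ r r′ → Monic b → DegreeBelow (deg b) r → DegreeBelow (deg b) r′ →
                    (b *ₚ h) +ₚ r ≋ (b *ₚ h′) +ₚ r′ → h ≋ h′ × r ≋ r′
  division-unique b h h′ r r′ monic small small′ e = h≋h′ , r≋r′
    where
    b[h-h′]≋r′-r : (b *ₚ (h -ₚ h′)) ≋ (r′ -ₚ r)
    b[h-h′]≋r′-r = ≋-trans (solve 5 (λ B H H′ R R′ → B :* (H :- H′) := ((B :* H :+ R) :- (B :* H′ :+ R′)) :+ (R′ :- R)) ≋-refl b h h′ r r′)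
      (+ₚ-cong (≋-trans (+ₚ-cong e ≋-refl) (-ₚ-inverseʳ ((b *ₚ h′) +ₚ r′))) ≋-refl)
    h-h′≈0 : (h -ₚ h′) ≋ []
    h-h′≈0 = monic-*ₚ-small b (h -ₚ h′) monic (degreeBelow-cong (≋-sym b[h-h′]≋r′-r) (degreeBelow-sub {p = r′} small′ small))
    h≋h′ : h ≋ h′
    h≋h′ = -ₚ≋[]⇒≋ h-h′≈0
    r≋r′ : r ≋ r′
    r≋r′ = ≋-trans (solve 3 (λ B H R → R := (B :* H :+ R) :- (B :* H)) ≋-refl b h r)
           (≋-trans (+ₚ-cong e (-ₚ-cong (*ₚ-congˡ b h≋h′)))
           (≋-sym (solve 3 (λ B H R → R := (B :* H :+ R) :- (B :* H)) ≋-refl b h′ r′)))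

  infix 4 _∣_
  _∣_ : Pol → Pol → Set (c ⊔ ℓ)
  d ∣ x = Σ Pol λ k → x ≋ d *ₚ k

  ∣-respʳ : ∀ {a x y} → x ≋ y → a ∣ x → a ∣ y
  ∣-respʳ x≋y (k , x≋ak) = k , ≋-trans (≋-sym x≋y) x≋ak

  ∣-trans : ∀ {a b x} → a ∣ b → b ∣ x → a ∣ x
  ∣-trans {a} (k , b≋ak) (k′ , x≋bk′) = k *ₚ k′ , ≋-trans x≋bk′ (≋-trans (*ₚ-congʳ k′ b≋ak) (*ₚ-assoc a k k′))

  record Bezout (a b : Pol) : Set (c ⊔ ℓ) where
    constructor mkBezout
    field
      gcd cofactorˡ cofactorʳ : Pol
      bezout-identity : gcd ≋ (cofactorˡ *ₚ a) +ₚ (cofactorʳ *ₚ b)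
      gcd∣ˡ : gcd ∣ a
      gcd∣ʳ : gcd ∣ b
  open Bezout public

  bezout-zeroʳ : ∀ a b → b ≋ [] → Bezout a b
  bezout-zeroʳ a b b≈0 = mkBezout a 1ₚ [] a≋1a+0b (1ₚ , ≋-sym (*ₚ-identityʳ a)) ([] , ≋-trans b≈0 (≋-sym (*ₚ-zeroʳ a)))
    where
    a≋1a+0b : a ≋ (1ₚ *ₚ a) +ₚ ([] *ₚ b)
    a≋1a+0b = ≋-sym (≋-trans (+ₚ-identityʳ (1ₚ *ₚ a)) (*ₚ-identityˡ a))

  -- Euclid's algorithm, with fuel bounding the degree of the second argument.
  extendedEuclid : ∀ n a b → DegreeBelow n b → Bezout a b
  extendedEuclid zero    a b small = bezout-zeroʳ a b (degreeBelow-0 small)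
  extendedEuclid (suc n) a b small with ≋[]? b
  ... | yes b≈0 = bezout-zeroʳ a b b≈0
  ... | no  b≉0 = mkBezout (gcd G) (cofactorʳ G) (cofactorˡ G -ₚ cofactorʳ G *ₚ (K *ₚ q)) identity gcd∣a (gcd∣ˡ G)
    where
    k = inv (lead b) (lead≉0 b b≉0)
    K = const k
    K≉0 : ¬ (K ≋ [])
    K≉0 K≈0 = 1≉0 (trans (sym (*-inverseˡ (lead b) (lead≉0 b b≉0))) (trans (*-congʳ (coeff-≈ K≈0 0)) (zeroˡ _)))
    Kb-monic : Monic (K *ₚ b)
    Kb-monic = trans (lead-*ₚ K b K≉0 b≉0) (*-inverseˡ (lead b) (lead≉0 b b≉0))
    D = divideByMonic (K *ₚ b) Kb-monic a
    q = quotient D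
    r = remainder D
    r-small : DegreeBelow n r
    r-small = degreeBelow-mono {p = r} (≡.subst (_≤ n) (≡.sym (deg-*ₚ K b K≉0 b≉0)) (degreeBelow⇒deg≤ b n small)) (remainder-small D)
    G = extendedEuclid n b r r-small
    gcd∣a : gcd G ∣ a
    gcd∣a = K *ₚ proj₁ (gcd∣ˡ G) *ₚ q +ₚ proj₁ (gcd∣ʳ G)
          , ≋-trans (division D) (≋-trans (+ₚ-cong (*ₚ-congʳ q (*ₚ-congˡ K (proj₂ (gcd∣ˡ G)))) (proj₂ (gcd∣ʳ G)))
              (solve 5 (λ Kx G K1 Q KR → (Kx :* (G :* K1)) :* Q :+ G :* KR := G :* (Kx :* K1 :* Q :+ KR)) ≋-refl K (gcd G) _ q _))
    r≋a-Kbq : r ≋ a -ₚ (K *ₚ b) *ₚ q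
    r≋a-Kbq = ≋-trans (solve 3 (λ B Q R → R := (B :* Q :+ R) :- B :* Q) ≋-refl (K *ₚ b) q r) (+ₚ-cong (≋-sym (division D)) ≋-refl)
    identity : gcd G ≋ (cofactorʳ G *ₚ a) +ₚ ((cofactorˡ G -ₚ cofactorʳ G *ₚ (K *ₚ q)) *ₚ b)
    identity = ≋-trans (bezout-identity G) (≋-trans (+ₚ-cong ≋-refl (*ₚ-congˡ (cofactorʳ G) r≋a-Kbq))
      (solve 6 (λ S T A Kx B Q → S :* B :+ T :* (A :- (Kx :* B) :* Q) := T :* A :+ (S :- T :* (Kx :* Q)) :* B) ≋-refl
               (cofactorˡ G) (cofactorʳ G) a K b q))

module Congruence {c ℓ} (F : FiniteField c ℓ) (P : Poly.Pol F) where
  open FiniteField F hiding (zero)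
  open Poly F
  open PolynomialRing F
  open Division F using (_∣_; ∣-respʳ)
  open IntegerRingSolver polynomialRing using (solve; _:=_; _:+_; _:*_; _:-_; :-_)

  infix 4 _≡ᴾ_
  record _≡ᴾ_ (x y : Pol) : Set (c ⊔ ℓ) where
    constructor mk≡ᴾ
    field P∣x-y : P ∣ x -ₚ y
  open _≡ᴾ_ public

  ≋⇒≡ᴾ : ∀ {x y} → x ≋ y → x ≡ᴾ y
  ≋⇒≡ᴾ {x} {y} x≋y = mk≡ᴾ ([] , ≋-trans (+ₚ-cong x≋y ≋-refl) (≋-trans (-ₚ-inverseʳ y) (≋-sym (*ₚ-zeroʳ P))))

  ≡ᴾ-refl : ∀ {x} → x ≡ᴾ x
  ≡ᴾ-refl = ≋⇒≡ᴾ ≋-refl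

  ≡ᴾ-sym : ∀ {x y} → x ≡ᴾ y → y ≡ᴾ x
  ≡ᴾ-sym {x} {y} (mk≡ᴾ (h , e)) = mk≡ᴾ (-ₚ h ,
    ≋-trans (solve 2 (λ x y → y :- x := :- (x :- y)) ≋-refl x y)
    (≋-trans (-ₚ-cong e) (solve 2 (λ P h → :- (P :* h) := P :* (:- h)) ≋-refl P h)))

  ≡ᴾ-trans : ∀ {x y z} → x ≡ᴾ y → y ≡ᴾ z → x ≡ᴾ z
  ≡ᴾ-trans {x} {y} {z} (mk≡ᴾ (h , e)) (mk≡ᴾ (h′ , e′)) = mk≡ᴾ (h +ₚ h′ ,
    ≋-trans (solve 3 (λ x y z → x :- z := (x :- y) :+ (y :- z)) ≋-refl x y z)
    (≋-trans (+ₚ-cong e e′) (≋-sym (*ₚ-distribˡ P h h′))))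

  +ₚ-cong-≡ᴾ : ∀ {x x′ y y′} → x ≡ᴾ x′ → y ≡ᴾ y′ → x +ₚ y ≡ᴾ x′ +ₚ y′
  +ₚ-cong-≡ᴾ {x} {x′} {y} {y′} (mk≡ᴾ (h , e)) (mk≡ᴾ (h′ , e′)) = mk≡ᴾ (h +ₚ h′ ,
    ≋-trans (solve 4 (λ x x′ y y′ → (x :+ y) :- (x′ :+ y′) := (x :- x′) :+ (y :- y′)) ≋-refl x x′ y y′)
    (≋-trans (+ₚ-cong e e′) (≋-sym (*ₚ-distribˡ P h h′))))

  *ₚ-cong-≡ᴾ : ∀ {x x′ y y′} → x ≡ᴾ x′ → y ≡ᴾ y′ → x *ₚ y ≡ᴾ x′ *ₚ y′
  *ₚ-cong-≡ᴾ {x} {x′} {y} {y′} (mk≡ᴾ (h , e)) (mk≡ᴾ (h′ , e′)) = mk≡ᴾ (h *ₚ y +ₚ x′ *ₚ h′ ,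
    ≋-trans (solve 4 (λ x x′ y y′ → (x :* y) :- (x′ :* y′) := (x :- x′) :* y :+ x′ :* (y :- y′)) ≋-refl x x′ y y′)
    (≋-trans (+ₚ-cong (*ₚ-congʳ y e) (*ₚ-congˡ x′ e′))
      (solve 5 (λ P h y x′ h′ → (P :* h) :* y :+ x′ :* (P :* h′) := P :* (h :* y :+ x′ :* h′)) ≋-refl P h y x′ h′)))

  -ₚ-cong-≡ᴾ : ∀ {x x′} → x ≡ᴾ x′ → -ₚ x ≡ᴾ -ₚ x′
  -ₚ-cong-≡ᴾ {x} {x′} (mk≡ᴾ (h , e)) = mk≡ᴾ (-ₚ h ,
    ≋-trans (solve 2 (λ x x′ → (:- x) :- (:- x′) := :- (x :- x′)) ≋-refl x x′)
    (≋-trans (-ₚ-cong e) (solve 2 (λ P h → :- (P :* h) := P :* (:- h)) ≋-refl P h)))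

  *ₚ-congˡ-≡ᴾ : ∀ z {x y} → x ≡ᴾ y → z *ₚ x ≡ᴾ z *ₚ y
  *ₚ-congˡ-≡ᴾ z = *ₚ-cong-≡ᴾ (≡ᴾ-refl {z})

  *ₚ-congʳ-≡ᴾ : ∀ z {x y} → x ≡ᴾ y → x *ₚ z ≡ᴾ y *ₚ z
  *ₚ-congʳ-≡ᴾ z x≡y = *ₚ-cong-≡ᴾ x≡y (≡ᴾ-refl {z})

  residueRing : CommutativeRing c (c ⊔ ℓ)
  residueRing = record
    { Carrier = Pol
    ; _≈_ = _≡ᴾ_
    ; _+_ = _+ₚ_
    ; _*_ = _*ₚ_
    ; -_ = -ₚ_
    ; 0# = []
    ; 1# = 1ₚ
    ; isCommutativeRing = record
      { isRing = record
        { +-isAbelianGroup = record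
          { isGroup = record
            { isMonoid = record
              { isSemigroup = record
                { isMagma = record
                  { isEquivalence = record { refl = ≡ᴾ-refl ; sym = ≡ᴾ-sym ; trans = ≡ᴾ-trans }
                  ; ∙-cong = +ₚ-cong-≡ᴾ }
                ; assoc = λ x y z → ≋⇒≡ᴾ (+ₚ-assoc x y z) }
              ; identity = (λ x → ≡ᴾ-refl) , (λ x → ≋⇒≡ᴾ (+ₚ-identityʳ x)) }
            ; inverse = (λ x → ≋⇒≡ᴾ (-ₚ-inverseˡ x)) , (λ x → ≋⇒≡ᴾ (-ₚ-inverseʳ x))
            ; ⁻¹-cong = -ₚ-cong-≡ᴾ }
          ; comm = λ x y → ≋⇒≡ᴾ (+ₚ-comm x y) }
        ; *-cong = *ₚ-cong-≡ᴾ
        ; *-assoc = λ x y z → ≋⇒≡ᴾ (*ₚ-assoc x y z)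
        ; *-identity = (λ x → ≋⇒≡ᴾ (*ₚ-identityˡ x)) , (λ x → ≋⇒≡ᴾ (*ₚ-identityʳ x))
        ; distrib = (λ x y z → ≋⇒≡ᴾ (*ₚ-distribˡ x y z)) , (λ x y z → ≋⇒≡ᴾ (*ₚ-distribʳ y z x)) }
      ; *-comm = λ x y → ≋⇒≡ᴾ (*ₚ-comm x y) } }

  module Residue = CommutativeRing residueRing

  P∣⇒≡ᴾ0 : ∀ {x} → P ∣ x → x ≡ᴾ []
  P∣⇒≡ᴾ0 {x} P∣x = mk≡ᴾ (∣-respʳ {P} (≋-sym (+ₚ-identityʳ x)) P∣x)

  ≡ᴾ0⇒P∣ : ∀ {x} → x ≡ᴾ [] → P ∣ x
  ≡ᴾ0⇒P∣ {x} x≡0 = ∣-respʳ {P} (+ₚ-identityʳ x) (P∣x-y x≡0)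

  ≡ᴾ⇒≡[modₚ] : ∀ {x y} → x ≡ᴾ y → x ≡ y [modₚ P ]
  ≡ᴾ⇒≡[modₚ] (mk≡ᴾ (k , x-y≋Pk)) = k , coeff-≈ x-y≋Pk

  P*h+r≡ᴾr : ∀ h r → (P *ₚ h) +ₚ r ≡ᴾ r
  P*h+r≡ᴾr h r = mk≡ᴾ (h , solve 3 (λ P H R → (P :* H :+ R) :- R := P :* H) ≋-refl P h r)

  P≡ᴾ0 : P ≡ᴾ []
  P≡ᴾ0 = P∣⇒≡ᴾ0 (1ₚ , ≋-sym (*ₚ-identityʳ P))

  ^ₚ-cong-≡ᴾ : ∀ {x y} n → x ≡ᴾ y → x ^ₚ n ≡ᴾ y ^ₚ n
  ^ₚ-cong-≡ᴾ zero    _   = ≡ᴾ-refl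
  ^ₚ-cong-≡ᴾ (suc n) x≡y = *ₚ-cong-≡ᴾ x≡y (^ₚ-cong-≡ᴾ n x≡y)

module ModuloIrreducible {c ℓ} (F : FiniteField c ℓ) (P : Poly.Pol F)
                         (P-monic : Poly.Monic F P) (P-irreducible : Poly.Irreducible F P) where
  open FiniteField F hiding (zero)
  open Poly F
  open PolynomialRing F
  open FieldInverse F
  open Degree F
  open Division F
  open IntegerRingSolver polynomialRing using (solve; _:=_; _:+_; _:*_; _:-_; :-_; con)

  open Congruence F P public

  d : ℕ
  d = deg P

  1≤d : 1 ≤ d
  1≤d = proj₁ P-irreducible

  P≉0 : ¬ (P ≋ [])
  P≉0 = monic⇒≉0 P-monic

  divideByP : ∀ g → DivisionWithRemainder P g
  divideByP = divideByMonic P P-monic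

  reduce : Pol → Pol
  reduce g = remainder (divideByP g)

  ≡ᴾ-reduce : ∀ g → g ≡ᴾ reduce g
  ≡ᴾ-reduce g = ≡ᴾ-trans (≋⇒≡ᴾ (division (divideByP g))) (P*h+r≡ᴾr (quotient (divideByP g)) (reduce g))

  small-P∣⇒≋0 : ∀ {r} → DegreeBelow d r → P ∣ r → r ≋ []
  small-P∣⇒≋0 {r} small (k , r≋Pk) =
    ≋-trans r≋Pk (≋-trans (*ₚ-congˡ P (monic-*ₚ-small P k P-monic (degreeBelow-cong r≋Pk small))) (*ₚ-zeroʳ P))

  degreeBelow-d-const : ∀ a → DegreeBelow d (const a)
  degreeBelow-d-const a zero    d≤0 = ⊥-elim (ℕ.<⇒≱ 1≤d d≤0)
  degreeBelow-d-const a (suc i) _   = refl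

  P∤1 : ¬ P ∣ 1ₚ
  P∤1 P∣1 = 1≉0 (coeff-≈ (small-P∣⇒≋0 (degreeBelow-d-const 1#) P∣1) 0)

  P∣? : ∀ x → Dec (P ∣ x)
  P∣? x with ≋[]? (reduce x)
  ... | yes r≈0 = yes (≡ᴾ0⇒P∣ (≡ᴾ-trans (≡ᴾ-reduce x) (≋⇒≡ᴾ r≈0)))
  ... | no  r≉0 = no λ P∣x → r≉0 (small-P∣⇒≋0 (remainder-small (divideByP x))
                                   (≡ᴾ0⇒P∣ (≡ᴾ-trans (≡ᴾ-sym (≡ᴾ-reduce x)) (P∣⇒≡ᴾ0 P∣x))))

  constant-cofactor⇒P∣ : ∀ g k → P ≋ g *ₚ k → deg k ≡ 0 → P ∣ g
  constant-cofactor⇒P∣ g k P≋gk deg-k≡0 = const κ⁻¹ , ≋-sym P·κ⁻¹≋g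
    where
    κ = coeff k 0
    k≋κ : k ≋ const κ
    k≋κ = deg≡0⇒const k deg-k≡0
    κ≉0 : ¬ (κ ≈ 0#)
    κ≉0 κ≈0 = P≉0 (≋-trans P≋gk (≋-trans (*ₚ-congˡ g (≋-trans k≋κ (const-zero κ≈0))) (*ₚ-zeroʳ g)))
    κ⁻¹ = inv κ κ≉0
    P·κ⁻¹≋g : P *ₚ const κ⁻¹ ≋ g
    P·κ⁻¹≋g = ≋-trans (*ₚ-congʳ (const κ⁻¹) P≋gk) (≋-trans (*ₚ-assoc g k (const κ⁻¹))
      (≋-trans (*ₚ-congˡ g (≋-trans (*ₚ-congʳ (const κ⁻¹) k≋κ) (≋-trans (const-*ₚ-const κ κ⁻¹) (const-cong (*-inverseʳ κ κ≉0)))))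
               (*ₚ-identityʳ g)))

  constant-gcd⇒inverse : ∀ {r} (G : Bezout P r) → deg (gcd G) ≡ 0 → Σ Pol λ s → s *ₚ r ≡ᴾ 1ₚ
  constant-gcd⇒inverse {r} G deg-g≡0 = const γ⁻¹ *ₚ t , (begin
      (const γ⁻¹ *ₚ t) *ₚ r                     ≈⟨ Residue.*-assoc (const γ⁻¹) t r ⟩
      const γ⁻¹ *ₚ (t *ₚ r)                     ≈⟨ *ₚ-congˡ-≡ᴾ (const γ⁻¹) (≡ᴾ-sym sP+tr≡tr) ⟩
      const γ⁻¹ *ₚ (cofactorˡ G *ₚ P +ₚ t *ₚ r) ≈⟨ *ₚ-congˡ-≡ᴾ (const γ⁻¹) (≋⇒≡ᴾ (≋-sym (bezout-identity G))) ⟩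
      const γ⁻¹ *ₚ g                            ≈⟨ ≋⇒≡ᴾ γ⁻¹g≋1 ⟩
      1ₚ                                        ∎)
    where
    open import Relation.Binary.Reasoning.Setoid Residue.setoid
    t = cofactorʳ G
    g = gcd G
    sP+tr≡tr : cofactorˡ G *ₚ P +ₚ t *ₚ r ≡ᴾ t *ₚ r
    sP+tr≡tr = +ₚ-cong-≡ᴾ (≡ᴾ-trans (*ₚ-congˡ-≡ᴾ (cofactorˡ G) P≡ᴾ0) (≋⇒≡ᴾ (*ₚ-zeroʳ (cofactorˡ G)))) (≡ᴾ-refl {t *ₚ r})
    γ = coeff g 0
    g≋γ : g ≋ const γ
    g≋γ = deg≡0⇒const g deg-g≡0
    γ≉0 : ¬ (γ ≈ 0#)
    γ≉0 γ≈0 = P≉0 (≋-trans (proj₂ (gcd∣ˡ G)) (*ₚ-zeroˡ g _ (≋-trans g≋γ (const-zero γ≈0))))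
    γ⁻¹ = inv γ γ≉0
    γ⁻¹g≋1 : const γ⁻¹ *ₚ g ≋ 1ₚ
    γ⁻¹g≋1 = ≋-trans (*ₚ-congˡ (const γ⁻¹) g≋γ) (≋-trans (const-*ₚ-const γ⁻¹ γ) (const-cong (*-inverseˡ γ γ≉0)))

  inverseModP : ∀ r → ¬ P ∣ r → Σ Pol λ s → s *ₚ r ≡ᴾ 1ₚ
  inverseModP r P∤r = byIrreducibility (proj₂ P-irreducible (gcd G) k (coeff-≈ P≋gk))
    where
    G = extendedEuclid (suc (deg r)) P r (degreeBelow-1+deg r)
    k = proj₁ (gcd∣ˡ G)
    P≋gk = proj₂ (gcd∣ˡ G)
    byIrreducibility : deg (gcd G) ≡ 0 ⊎ deg k ≡ 0 → Σ Pol λ s → s *ₚ r ≡ᴾ 1ₚ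
    byIrreducibility (inj₁ deg-g≡0) = constant-gcd⇒inverse G deg-g≡0
    byIrreducibility (inj₂ deg-k≡0) = ⊥-elim (P∤r (∣-trans {P} (constant-cofactor⇒P∣ (gcd G) k P≋gk deg-k≡0) (gcd∣ʳ G)))

  euclid : ∀ x y → P ∣ x *ₚ y → ¬ P ∣ x → P ∣ y
  euclid x y P∣xy P∤x = ≡ᴾ0⇒P∣ (begin
    y                ≈⟨ Residue.sym (Residue.*-identityˡ y) ⟩
    1ₚ *ₚ y          ≈⟨ *ₚ-congʳ-≡ᴾ y (≡ᴾ-sym sx≡1) ⟩
    (s *ₚ x) *ₚ y    ≈⟨ Residue.*-assoc s x y ⟩
    s *ₚ (x *ₚ y)    ≈⟨ *ₚ-congˡ-≡ᴾ s (P∣⇒≡ᴾ0 P∣xy) ⟩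
    s *ₚ []          ≈⟨ Residue.zeroʳ s ⟩
    []               ∎)
    where
    open import Relation.Binary.Reasoning.Setoid Residue.setoid
    s = proj₁ (inverseModP x P∤x)
    sx≡1 = proj₂ (inverseModP x P∤x)

  ≡ᴾ? : ∀ x y → Dec (x ≡ᴾ y)
  ≡ᴾ? x y with P∣? (x -ₚ y)
  ... | yes P∣x-y = yes (mk≡ᴾ P∣x-y)
  ... | no  P∤x-y = no (λ x≡y → P∤x-y (P∣x-y x≡y))

  -1ₚ*-1ₚ≡1ₚ : -1ₚ *ₚ -1ₚ ≡ᴾ 1ₚ
  -1ₚ*-1ₚ≡1ₚ = ≋⇒≡ᴾ (solve 0 (:- con (+ 1) :* :- con (+ 1) := con (+ 1)) ≋-refl)

  P∤-1ₚ : ¬ P ∣ -1ₚ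
  P∤-1ₚ (k , -1≋Pk) = P∤1 (-ₚ k , ≋-trans (solve 0 (con (+ 1) := :- (:- con (+ 1))) ≋-refl)
                                  (≋-trans (-ₚ-cong -1≋Pk) (solve 2 (λ P K → :- (P :* K) := P :* (:- K)) ≋-refl P k)))

  square-root-of-1 : ∀ x → x *ₚ x ≡ᴾ 1ₚ → x ≡ᴾ 1ₚ ⊎ x ≡ᴾ -1ₚ
  square-root-of-1 x x²≡1 with P∣? (x -ₚ 1ₚ)
  ... | yes P∣x-1 = inj₁ (mk≡ᴾ P∣x-1)
  ... | no  P∤x-1 = inj₂ (mk≡ᴾ (∣-respʳ {P} x+1≋x--1 (euclid (x -ₚ 1ₚ) (x +ₚ 1ₚ) (∣-respʳ {P} x²-1≋[x-1][x+1] (P∣x-y x²≡1)) P∤x-1)))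
    where
    x²-1≋[x-1][x+1] : (x *ₚ x) -ₚ 1ₚ ≋ (x -ₚ 1ₚ) *ₚ (x +ₚ 1ₚ)
    x²-1≋[x-1][x+1] = solve 1 (λ X → X :* X :- con (+ 1) := (X :- con (+ 1)) :* (X :+ con (+ 1))) ≋-refl x
    x+1≋x--1 : x +ₚ 1ₚ ≋ x -ₚ -1ₚ
    x+1≋x--1 = solve 1 (λ X → X :+ con (+ 1) := X :- (:- con (+ 1))) ≋-refl x

module PolynomialPowers {c ℓ} (F : FiniteField c ℓ) where
  open FiniteField F hiding (zero)
  open Poly F
  open PolynomialRing F
  open import Algebra.Properties.CommutativeSemiring.Exp (CommutativeRing.commutativeSemiring polynomialRing)
    using (_^_; ^-distrib-*; ^-assocʳ)

  ^≡^ₚ : ∀ x n → x ^ n ≡ x ^ₚ n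
  ^≡^ₚ x zero    = ≡.refl
  ^≡^ₚ x (suc n) = ≡.cong (x *ₚ_) (^≡^ₚ x n)

  ^ₚ-distrib-*ₚ : ∀ x y n → (x *ₚ y) ^ₚ n ≋ (x ^ₚ n) *ₚ (y ^ₚ n)
  ^ₚ-distrib-*ₚ x y n rewrite ≡.sym (^≡^ₚ (x *ₚ y) n) | ≡.sym (^≡^ₚ x n) | ≡.sym (^≡^ₚ y n) = ^-distrib-* x y n

  ^ₚ-assoc : ∀ x m n → (x ^ₚ m) ^ₚ n ≋ x ^ₚ (m ℕ.* n)
  ^ₚ-assoc x m n rewrite ≡.sym (^≡^ₚ (x ^ₚ m) n) | ≡.sym (^≡^ₚ x m) | ≡.sym (^≡^ₚ x (m ℕ.* n)) = ^-assocʳ x m n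

  const-signPow : ∀ j → const (signPow j) ≋ -1ₚ ^ₚ j
  const-signPow zero    = ≋-refl
  const-signPow (suc j) = ≋-trans (≋-sym (const-*ₚ-const (- 1#) (signPow j))) (*ₚ-congˡ -1ₚ (const-signPow j))

  ^ₚ-signPow : ∀ x k n → (x *ₚ (-1ₚ ^ₚ k)) ^ₚ n ≋ const (signPow (k ℕ.* n)) *ₚ (x ^ₚ n)
  ^ₚ-signPow x k n =
    ≋-trans (^ₚ-distrib-*ₚ x _ n) (≋-trans (*ₚ-comm (x ^ₚ n) ((-1ₚ ^ₚ k) ^ₚ n)) (*ₚ-congʳ (x ^ₚ n) (≋-trans (^ₚ-assoc _ k n) (≋-sym (const-signPow (k ℕ.* n))))))

module MonicPolynomials {c ℓ} (F : FiniteField c ℓ) where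
  open FiniteField F hiding (zero)
  open Poly F
  open PolynomialRing F
  open Degree F
  open import Data.List.Relation.Unary.Unique.Setoid.Properties using (cartesianProductWith⁺)

  polynomialSetoid : Setoid c ℓ
  polynomialSetoid = CommutativeRing.setoid polynomialRing

  MonicOfDegree : ℕ → Pol → Set ℓ
  MonicOfDegree j p = Monic p × deg p ≡ j

  MonicOfDegree-cong : ∀ {j p q} → p ≋ q → MonicOfDegree j p → MonicOfDegree j q
  MonicOfDegree-cong p≋q (monic , deg≡j) = trans (sym (lead-cong p≋q)) monic , ≡.trans (≡.sym (deg-cong p≋q)) deg≡j

  deg-∷ : ∀ a p → ¬ (p ≋ []) → deg (a ∷ p) ≡ suc (deg p)
  deg-∷ a p p≉0 with isZero? p
  ... | yes p≈0 = ⊥-elim (p≉0 (All≈0⇒≋[] p≈0))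
  ... | no  _   = ≡.refl

  MonicOfDegree-∷ : ∀ {j} a {p} → MonicOfDegree j p → MonicOfDegree (suc j) (a ∷ p)
  MonicOfDegree-∷ a {p} (monic , deg≡j) rewrite deg-∷ a p (monic⇒≉0 monic) = monic , ≡.cong suc deg≡j

  monics : ℕ → List Pol
  monics zero    = 1ₚ ∷ []
  monics (suc j) = List.cartesianProductWith _∷_ elements (monics j)

  monics-sound : ∀ j → All (MonicOfDegree j) (monics j)
  monics-sound zero    = (refl , ≡.refl) ∷ []
  monics-sound (suc j) = Allₚ.cartesianProductWith⁺ setoid polynomialSetoid _∷_ elements (monics j)
    λ {a} _ p∈ → let (monic , p≋q) = All.lookupAny (monics-sound j) p∈ in
                 MonicOfDegree-∷ a (MonicOfDegree-cong (≋-sym p≋q) monic)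

  monics-complete : ∀ j p → MonicOfDegree j p → Any (p ≋_) (monics j)
  monics-complete zero    p (monic , deg≡0) = here (≋-trans (deg≡0⇒const p deg≡0) (const-cong (≡.subst (λ k → coeff p k ≈ 1#) deg≡0 monic)))
  monics-complete (suc j) []      (_ , ())
  monics-complete (suc j) (a ∷ p) (monic , deg≡1+j) with isZero? p
  ... | yes _ = ⊥-elim (ℕ.0≢1+n deg≡1+j)
  ... | no  _ = Anyₚ.cartesianProductWith⁺ _∷_ ∷-cong (complete a) (monics-complete j p (monic , ℕ.suc-injective deg≡1+j))

  monics-distinct : ∀ j → AllPairs (λ p q → ¬ (p ≋ q)) (monics j)
  monics-distinct zero    = [] ∷ []
  monics-distinct (suc j) = cartesianProductWith⁺ setoid polynomialSetoid polynomialSetoid _∷_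
                              (λ e → coeff-≈ e 0 , ∷-injectiveʳ e) distinct (monics-distinct j)

module ResiduesOfMonics {c ℓ} (F : FiniteField c ℓ) (P : Poly.Pol F)
                        (P-monic : Poly.Monic F P) (P-irreducible : Poly.Irreducible F P) where
  open FiniteField F hiding (zero)
  open Poly F
  open PolynomialRing F
  open Degree F
  open Division F
  open ModuloIrreducible F P P-monic P-irreducible
  open MonicPolynomials F
  open IntegerRingSolver polynomialRing using (solve; _:=_; _:*_)
  module Polys    = EnumerationProducts (CommutativeRing.*-commutativeMonoid polynomialRing)
  module Residues = EnumerationProducts (CommutativeRing.*-commutativeMonoid residueRing)

  Enumerates⇒ : ∀ {s t} {S : Pol → Set s} {T : Pol → Set t} {L} →
                (∀ g → S g → T g) → (∀ g → T g → S g) → Enumerates S L → Polys.Enumerates T L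
  Enumerates⇒ S⇒T T⇒S (all , complete , distinct) =
    All.map (S⇒T _) all , (λ g tg → Any.map mk≋ (complete g (T⇒S g tg))) , AllPairs.map (λ g≉h g≋h → g≉h (coeff-≈ g≋h)) distinct

  CoprimeOfDegree : ℕ → Pol → Set (c ⊔ ℓ)
  CoprimeOfDegree n g = Monic g × deg g ≡ n × ¬ P ∣ g

  CoprimeBelow : ℕ → Pol → Set (c ⊔ ℓ)
  CoprimeBelow n g = Monic g × deg g < n × ¬ P ∣ g

  quotientByP : Pol → Pol
  quotientByP g = quotient (divideByP g)

  module _ (q r : Pol) (q≉0 : ¬ (q ≋ [])) (r-small : DegreeBelow d r) where
    private
      deg-Pq : deg (P *ₚ q) ≡ d ℕ.+ deg q
      deg-Pq = deg-*ₚ P q P≉0 q≉0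
      top : coeff ((P *ₚ q) +ₚ r) (d ℕ.+ deg q) ≈ lead q
      top = trans (coeff-+ₚ (P *ₚ q) r _)
              (trans (+-cong (≡.subst (λ k → coeff (P *ₚ q) k ≈ lead q) deg-Pq
                               (trans (lead-*ₚ P q P≉0 q≉0) (trans (*-congʳ P-monic) (*-identityˡ _))))
                             (r-small _ (ℕ.m≤m+n d (deg q))))
                     (+-identityʳ _))
      below : DegreeBelow (suc (d ℕ.+ deg q)) ((P *ₚ q) +ₚ r)
      below i le = trans (coeff-+ₚ (P *ₚ q) r i)
        (trans (+-cong (degreeBelow-1+deg (P *ₚ q) i (≡.subst (λ k → suc k ≤ i) (≡.sym deg-Pq) le))
                       (r-small i (ℕ.≤-trans (ℕ.m≤m+n d (deg q)) (ℕ.≤-trans (ℕ.n≤1+n _) le))))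
               (+-identityʳ 0#))

    deg-P*q+r : deg ((P *ₚ q) +ₚ r) ≡ d ℕ.+ deg q
    deg-P*q+r = deg-exact ((P *ₚ q) +ₚ r) _ (λ top≈0 → lead≉0 q q≉0 (trans (sym top) top≈0)) below

    lead-P*q+r : lead ((P *ₚ q) +ₚ r) ≈ lead q
    lead-P*q+r rewrite deg-P*q+r = top

  quotientByP-monicOfDegree : ∀ n g → d ≤ n → CoprimeOfDegree n g → MonicOfDegree (n ∸ d) (quotientByP g)
  quotientByP-monicOfDegree n g d≤n (monic , deg≡n , _) with ≋[]? (quotientByP g)
  ... | yes q≈0 = ⊥-elim (lead≉0 g (monic⇒≉0 monic)
                   (≡.subst (λ k → coeff g k ≈ 0#) (≡.sym deg≡n) (degreeBelow-cong (≋-sym g≋r) (remainder-small D) n d≤n)))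
    where
    D = divideByP g
    g≋r : g ≋ remainder D
    g≋r = ≋-trans (division D) (+ₚ-cong (≋-trans (*ₚ-congˡ P q≈0) (*ₚ-zeroʳ P)) ≋-refl)
  ... | no  q≉0 = lead-q≈1 , deg-q≡n∸d
    where
    D = divideByP g
    lead-q≈1 : Monic (quotientByP g)
    lead-q≈1 = trans (sym (lead-P*q+r _ _ q≉0 (remainder-small D))) (trans (sym (lead-cong (division D))) monic)
    deg-q≡n∸d : deg (quotientByP g) ≡ n ∸ d
    deg-q≡n∸d = ≡.trans (≡.sym (ℕ.m+n∸m≡n d _))
                 (≡.cong (_∸ d) (≡.trans (≡.sym (deg-P*q+r _ _ q≉0 (remainder-small D))) (≡.trans (≡.sym (deg-cong (division D))) deg≡n)))

  quotientByP-cong : ∀ {g g′} → g ≋ g′ → quotientByP g ≋ quotientByP g′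
  quotientByP-cong {g} {g′} g≋g′ = proj₁ (division-unique P _ _ _ _ P-monic (remainder-small (divideByP g)) (remainder-small (divideByP g′))
    (≋-trans (≋-sym (division (divideByP g))) (≋-trans g≋g′ (division (divideByP g′)))))

  reduce-cong-≡ᴾ : ∀ {g g′} → g ≡ᴾ g′ → reduce g ≋ reduce g′
  reduce-cong-≡ᴾ {g} {g′} g≡g′ = -ₚ≋[]⇒≋ (small-P∣⇒≋0
    (degreeBelow-sub {p = reduce g} (remainder-small (divideByP g)) (remainder-small (divideByP g′)))
    (P∣x-y (≡ᴾ-trans (≡ᴾ-sym (≡ᴾ-reduce g)) (≡ᴾ-trans g≡g′ (≡ᴾ-reduce g′)))))

  Fibre : ℕ → Pol → Pol → Set (c ⊔ ℓ)
  Fibre n h g = CoprimeOfDegree n g × quotientByP g ≋ h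

  fibre-element : ∀ n h r → d ≤ n → MonicOfDegree (n ∸ d) h → DegreeBelow d r → ¬ P ∣ r → Fibre n h ((P *ₚ h) +ₚ r)
  fibre-element n h r d≤n (h-monic , deg-h) r-small P∤r =
    (trans (lead-P*q+r h r h≉0 r-small) h-monic , ≡.trans (deg-P*q+r h r h≉0 r-small) (≡.trans (≡.cong (d ℕ.+_) deg-h) (ℕ.m+[n∸m]≡n d≤n)) , P∤g)
    , ≋-sym (proj₁ (division-unique P h _ r _ P-monic r-small (remainder-small (divideByP g)) (division (divideByP g))))
    where
    h≉0 = monic⇒≉0 h-monic
    g = (P *ₚ h) +ₚ r
    P∤g : ¬ P ∣ g
    P∤g P∣g = P∤r (≡ᴾ0⇒P∣ (≡ᴾ-trans (≡ᴾ-sym (P*h+r≡ᴾr h r)) (P∣⇒≡ᴾ0 P∣g)))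

  fibre-≡ᴾ⇒≋ : ∀ n h {x y} → Fibre n h x → Fibre n h y → x ≡ᴾ y → x ≋ y
  fibre-≡ᴾ⇒≋ n h {x} {y} (_ , qx≋h) (_ , qy≋h) x≡y =
    ≋-trans (division (divideByP x))
    (≋-trans (+ₚ-cong (*ₚ-congˡ P (≋-trans qx≋h (≋-sym qy≋h))) (reduce-cong-≡ᴾ x≡y))
             (≋-sym (division (divideByP y))))

  open Residues.Wilson -1ₚ -1ₚ*-1ₚ≡1ₚ ≡ᴾ?

  fibres-distinct-mod-P : ∀ n h L → All (Fibre n h) L → Polys.Distinct L → Residues.Distinct L
  fibres-distinct-mod-P n h []      []          []                = []
  fibres-distinct-mod-P n h (x ∷ L) (fx ∷ fibre) (x∉L ∷ distinct) =
    All.zipWith (λ (fy , x≉y) x≡y → x≉y (fibre-≡ᴾ⇒≋ n h fx fy x≡y)) (fibre , x∉L) ∷ fibres-distinct-mod-P n h L fibre distinct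

  module _ n h (d≤n : d ≤ n) (h-monic : MonicOfDegree (n ∸ d) h) L (enum : Polys.Enumerates (Fibre n h) L) where

    private
      fibre-complete : ∀ r → DegreeBelow d r → ¬ P ∣ r → Any (λ y → (P *ₚ h) +ₚ r ≋ y) L
      fibre-complete r r-small P∤r = proj₁ (proj₂ enum) _ (fibre-element n h r d≤n h-monic r-small P∤r)

    fibre-inverseClosed : Residues.InverseClosed L
    fibre-inverseClosed = All.map inverseInFibre (proj₁ enum)
      where
      inverseInFibre : ∀ {g} → Fibre n h g → Residues.HasInverseIn L g
      inverseInFibre {g} ((_ , _ , P∤g) , _) = Any.map (λ {y} g′≋y → ≡ᴾ-trans (*ₚ-congˡ-≡ᴾ g (≡ᴾ-trans (≋⇒≡ᴾ (≋-sym g′≋y)) g′≡s)) gs≡1)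
                                               (fibre-complete (reduce s) (remainder-small (divideByP s)) P∤s′)
        where
        s    = proj₁ (inverseModP g P∤g)
        sg≡1 = proj₂ (inverseModP g P∤g)
        gs≡1 : g *ₚ s ≡ᴾ 1ₚ
        gs≡1 = ≡ᴾ-trans (≋⇒≡ᴾ (*ₚ-comm g s)) sg≡1
        g′≡s : (P *ₚ h) +ₚ reduce s ≡ᴾ s
        g′≡s = ≡ᴾ-trans (P*h+r≡ᴾr h (reduce s)) (≡ᴾ-sym (≡ᴾ-reduce s))
        P∤s′ : ¬ P ∣ reduce s
        P∤s′ P∣s′ = P∤1 (≡ᴾ0⇒P∣ (≡ᴾ-trans (≡ᴾ-sym sg≡1)
                      (≡ᴾ-trans (*ₚ-congʳ-≡ᴾ g (≡ᴾ-trans (≡ᴾ-reduce s) (P∣⇒≡ᴾ0 P∣s′))) (≋⇒≡ᴾ (*ₚ-zeroˡ [] g ≋-refl)))))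

    -1ₚ∈fibre : Any (_≡ᴾ -1ₚ) L
    -1ₚ∈fibre = Any.map (λ g≋y → ≡ᴾ-trans (≋⇒≡ᴾ (≋-sym g≋y)) (P*h+r≡ᴾr h -1ₚ)) (fibre-complete -1ₚ (degreeBelow-d-const (- 1#)) P∤-1ₚ)

    ∏-fibre≡-1 : prodₚ L ≡ᴾ -1ₚ
    ∏-fibre≡-1 with ∏-inverseClosed (length L) L ℕ.≤-refl (fibres-distinct-mod-P n h L (proj₁ enum) (proj₂ (proj₂ enum)))
                                   fibre-inverseClosed (All.tabulate (λ {x} _ → square-root-of-1 x))
    ... | inj₁ (_ , ∏≡-1)  = ∏≡-1
    ... | inj₂ (-1∉L , _) = ⊥-elim (-1∉L -1ₚ∈fibre)

  FibreOver : ℕ → List Pol → Pol → Set (c ⊔ ℓ)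
  FibreOver n H g = CoprimeOfDegree n g × Any (quotientByP g ≋_) H

  open Residues.SignOfLength -1ₚ -1ₚ*-1ₚ≡1ₚ

  ≋? : ∀ x y → Dec (x ≋ y)
  ≋? x y with ≋[]? (x -ₚ y)
  ... | yes x-y≈0 = yes (-ₚ≋[]⇒≋ x-y≈0)
  ... | no  x-y≉0 = no (λ x≋y → x-y≉0 (≋-trans (+ₚ-cong x≋y ≋-refl) (-ₚ-inverseʳ y)))

  ∏-fibres : ∀ n → d ≤ n → ∀ H → All (MonicOfDegree (n ∸ d)) H → Polys.Distinct H →
             ∀ L → Polys.Enumerates (FibreOver n H) L → prodₚ L ≡ᴾ m^length H
  ∏-fibres n d≤n []      _                _                []      _                  = ≡ᴾ-refl
  ∏-fibres n d≤n []      _                _                (x ∷ L) ((_ , ()) ∷ _ , _)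
  ∏-fibres n d≤n (h ∷ H) (h-monic ∷ monic) (h∉H ∷ distinct) L enum =
    ≡ᴾ-trans (≋⇒≡ᴾ (Polys.∏-partition Q? L))
             (*ₚ-cong-≡ᴾ (∏-fibre≡-1 n h d≤n h-monic (filter Q? L) enum-h)
                         (∏-fibres n d≤n H monic distinct (filter (∁? Q?) L) enum-H))
    where
    Q : Pol → Set ℓ
    Q g = quotientByP g ≋ h
    Q? : ∀ g → Dec (Q g)
    Q? g = ≋? (quotientByP g) h
    Q-resp : ∀ {x y} → x ≋ y → Q x → Q y
    Q-resp x≋y = ≋-trans (quotientByP-cong (≋-sym x≋y))
    enum-h : Polys.Enumerates (Fibre n h) (filter Q? L)
    enum-h = Polys.Enumerates-resp-⇔ (λ g ((t , _) , q) → t , q) (λ g (t , q) → (t , here q) , q)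
                                      (Polys.Enumerates-filter Q? Q-resp L enum)
    h∉ : ∀ {g} {H′} → All (λ h′ → ¬ (h ≋ h′)) H′ → Any (g ≋_) H′ → ¬ (g ≋ h)
    h∉ (h≉h′ ∷ _) (here g≋h′) g≋h = h≉h′ (≋-trans (≋-sym g≋h) g≋h′)
    h∉ (_ ∷ h∉H′) (there a)   g≋h = h∉ h∉H′ a g≋h
    enum-H : Polys.Enumerates (FibreOver n H) (filter (∁? Q?) L)
    enum-H = Polys.Enumerates-resp-⇔ drop-h add-h (Polys.Enumerates-filter (∁? Q?) (λ x≋y ¬Qx Qy → ¬Qx (Q-resp (≋-sym x≋y) Qy)) L enum)
      where
      drop-h : ∀ g → FibreOver n (h ∷ H) g × ¬ Q g → FibreOver n H g
      drop-h g ((t , here q≋h) , ¬q) = ⊥-elim (¬q q≋h)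
      drop-h g ((t , there a)  , _)  = t , a
      add-h : ∀ g → FibreOver n H g → FibreOver n (h ∷ H) g × ¬ Q g
      add-h g (t , a) = (t , there a) , h∉ h∉H a

  module _ (q-odd : ¬ (card % 2 ≡ 0)) where

    m^length-monics : ∀ j → m^length (monics j) ≡ᴾ -1ₚ
    m^length-monics zero    = ≋⇒≡ᴾ (*ₚ-identityʳ -1ₚ)
    m^length-monics (suc j) = ≡ᴾ-trans (m^length-cartesianProductWith _∷_ elements (monics j) (m^length-monics j))
                                       (m^length-odd elements q-odd)

    ∏-coprimeOfDegree : ∀ n → d ≤ n → ∀ L → Polys.Enumerates (CoprimeOfDegree n) L → prodₚ L ≡ᴾ -1ₚ
    ∏-coprimeOfDegree n d≤n L enum =
      ≡ᴾ-trans (∏-fibres n d≤n (monics (n ∸ d)) (monics-sound (n ∸ d)) (monics-distinct (n ∸ d)) L enum-fibres)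
               (m^length-monics (n ∸ d))
      where
      enum-fibres : Polys.Enumerates (FibreOver n (monics (n ∸ d))) L
      enum-fibres = Polys.Enumerates-resp-⇔
        (λ g t → t , monics-complete (n ∸ d) (quotientByP g) (quotientByP-monicOfDegree n g d≤n t)) (λ g → proj₁) enum

    ∏-coprimeBelow : ∀ k LP → Polys.Enumerates (CoprimeBelow d) LP →
                     ∀ L → Polys.Enumerates (CoprimeBelow (d ℕ.+ k)) L → prodₚ L ≡ᴾ prodₚ LP *ₚ (-1ₚ ^ₚ k)
    ∏-coprimeBelow zero LP enumP L enum =
      ≡ᴾ-trans (≋⇒≡ᴾ (Polys.∏-unique L LP (≡.subst (λ n → Polys.Enumerates (CoprimeBelow n) L) (ℕ.+-identityʳ d) enum) enumP))
               (≋⇒≡ᴾ (≋-sym (*ₚ-identityʳ (prodₚ LP))))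
    ∏-coprimeBelow (suc k) LP enumP L enum =
      ≡ᴾ-trans (≋⇒≡ᴾ (Polys.∏-partition Q? L))
      (≡ᴾ-trans (*ₚ-cong-≡ᴾ (∏-coprimeBelow k LP enumP (filter Q? L) enum-below)
                            (∏-coprimeOfDegree (d ℕ.+ k) (ℕ.m≤m+n d k) (filter (∁? Q?) L) enum-top))
                (≋⇒≡ᴾ (solve 3 (λ A M K → (A :* K) :* M := A :* (M :* K)) ≋-refl (prodₚ LP) -1ₚ (-1ₚ ^ₚ k))))
      where
      Q : Pol → Set
      Q g = deg g < d ℕ.+ k
      Q? : ∀ g → Dec (Q g)
      Q? g = deg g ℕ.<? d ℕ.+ k
      Q-resp : ∀ {x y} → x ≋ y → Q x → Q y
      Q-resp x≋y = ≡.subst (_< d ℕ.+ k) (deg-cong x≋y)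
      d+1+k≡1+d+k : d ℕ.+ suc k ≡ suc (d ℕ.+ k)
      d+1+k≡1+d+k = ℕ.+-suc d k
      enum-below : Polys.Enumerates (CoprimeBelow (d ℕ.+ k)) (filter Q? L)
      enum-below = Polys.Enumerates-resp-⇔
        (λ g ((monic , _ , P∤g) , lt) → monic , lt , P∤g)
        (λ g (monic , lt , P∤g) → (monic , ℕ.≤-trans lt (ℕ.+-monoʳ-≤ d (ℕ.n≤1+n k)) , P∤g) , lt)
        (Polys.Enumerates-filter Q? Q-resp L enum)
      enum-top : Polys.Enumerates (CoprimeOfDegree (d ℕ.+ k)) (filter (∁? Q?) L)
      enum-top = Polys.Enumerates-resp-⇔
        (λ g ((monic , lt , P∤g) , ¬lt) → monic , ℕ.≤-antisym (ℕ.≤-pred (≡.subst (deg g <_) d+1+k≡1+d+k lt)) (ℕ.≮⇒≥ ¬lt) , P∤g)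
        (λ g (monic , deg≡ , P∤g) → (monic , ≡.subst (_< d ℕ.+ suc k) (≡.sym deg≡) (≡.subst (d ℕ.+ k <_) (≡.sym d+1+k≡1+d+k) ℕ.≤-refl) , P∤g)
                                   , ℕ.<-irrefl deg≡)
        (Polys.Enumerates-filter (∁? Q?) (λ x≋y ¬Qx Qy → ¬Qx (Q-resp (≋-sym x≋y) Qy)) L enum)

module CoprimeToPrimePower {c ℓ} (F : FiniteField c ℓ) (P : Poly.Pol F)
                           (P-monic : Poly.Monic F P) (P-irreducible : Poly.Irreducible F P) where
  open FiniteField F hiding (zero)
  open Poly F
  open PolynomialRing F
  open FieldInverse F
  open Degree F
  open Division F
  open ModuloIrreducible F P P-monic P-irreducible
  open ResiduesOfMonics F P P-monic P-irreducible using (module Polys; CoprimeBelow; Enumerates⇒)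
  open IntegerRingSolver polynomialRing using (solve; _:=_; _:+_; _:*_; _:-_; :-_; con)

  P^-monic : ∀ e → Monic (P ^ₚ e)
  P^-monic zero    = refl
  P^-monic (suc e) = trans (lead-*ₚ P (P ^ₚ e) P≉0 (monic⇒≉0 (P^-monic e))) (trans (*-cong P-monic (P^-monic e)) (*-identityˡ _))

  deg-P^ : ∀ e → deg (P ^ₚ e) ≡ e ℕ.* d
  deg-P^ zero    = ≡.refl
  deg-P^ (suc e) = ≡.trans (deg-*ₚ P (P ^ₚ e) P≉0 (monic⇒≉0 (P^-monic e))) (≡.cong (d ℕ.+_) (deg-P^ e))

  bezout-P^ : ∀ g → ¬ P ∣ g → ∀ n → Σ Pol λ u → Σ Pol λ v → 1ₚ ≋ (u *ₚ g) +ₚ (v *ₚ (P ^ₚ n))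
  bezout-P^ g P∤g zero    = [] , 1ₚ , ≋-sym (*ₚ-identityˡ 1ₚ)
  bezout-P^ g P∤g (suc n) = u *ₚ (s *ₚ g -ₚ P *ₚ t) +ₚ v *ₚ (P ^ₚ n) *ₚ s , -ₚ (v *ₚ t) , identity
    where
    ih = bezout-P^ g P∤g n
    u = proj₁ ih
    v = proj₁ (proj₂ ih)
    s = proj₁ (inverseModP g P∤g)
    t = proj₁ (P∣x-y (proj₂ (inverseModP g P∤g)))
    sg-1≋Pt : (s *ₚ g) -ₚ 1ₚ ≋ P *ₚ t
    sg-1≋Pt = proj₂ (P∣x-y (proj₂ (inverseModP g P∤g)))
    1≋sg-Pt : 1ₚ ≋ (s *ₚ g) -ₚ (P *ₚ t)
    1≋sg-Pt = ≋-trans (solve 2 (λ S T → con (+ 1) := S :- (S :- con (+ 1))) ≋-refl (s *ₚ g) (P *ₚ t)) (+ₚ-cong ≋-refl (-ₚ-cong sg-1≋Pt))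
    identity : 1ₚ ≋ ((u *ₚ (s *ₚ g -ₚ P *ₚ t) +ₚ v *ₚ (P ^ₚ n) *ₚ s) *ₚ g) +ₚ ((-ₚ (v *ₚ t)) *ₚ (P *ₚ (P ^ₚ n)))
    identity = ≋-trans (≋-sym (*ₚ-identityˡ 1ₚ)) (≋-trans (*ₚ-cong (proj₂ (proj₂ ih)) 1≋sg-Pt)
      (solve 7 (λ U G V Q S P T → (U :* G :+ V :* Q) :* (S :* G :- P :* T)
                  := (U :* (S :* G :- P :* T) :+ V :* Q :* S) :* G :+ (:- (V :* T)) :* (P :* Q)) ≋-refl u g v (P ^ₚ n) s P t))

  module _ (a : Carrier) (a≉0 : ¬ (a ≈ 0#)) (e : ℕ) (f : Pol) (f≋aP^1+e : f ≋ const a *ₚ (P ^ₚ suc e)) where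

    coprime⇒P∤ : ∀ g → Coprime g f → ¬ P ∣ g
    coprime⇒P∤ g coprime (k , g≋Pk) = ℕ.<⇒≢ 1≤d (≡.sym (coprime P (k , coeff-≈ g≋Pk) (proj₁ P∣f , coeff-≈ (proj₂ P∣f))))
      where
      P∣f : P ∣ f
      P∣f = const a *ₚ (P ^ₚ e) , ≋-trans f≋aP^1+e (solve 3 (λ A P Q → A :* (P :* Q) := P :* (A :* Q)) ≋-refl (const a) P (P ^ₚ e))

    P∤⇒coprime : ∀ g → ¬ P ∣ g → Coprime g f
    P∤⇒coprime g P∤g δ (k₁ , g≈δk₁) (k₂ , f≈δk₂) =
      ℕ.m+n≡0⇒m≡0 (deg δ) (≡.trans (≡.sym (deg-*ₚ δ w δ≉0 w≉0)) (≡.sym (deg-cong 1≋δw)))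
      where
      u = proj₁ (bezout-P^ g P∤g (suc e))
      v = proj₁ (proj₂ (bezout-P^ g P∤g (suc e)))
      a⁻¹ = inv a a≉0
      P^1+e≋δa⁻¹k₂ : P ^ₚ suc e ≋ δ *ₚ (const a⁻¹ *ₚ k₂)
      P^1+e≋δa⁻¹k₂ = ≋-trans (≋-sym (*ₚ-identityˡ _))
        (≋-trans (*ₚ-congʳ (P ^ₚ suc e) (≋-sym (≋-trans (const-*ₚ-const a⁻¹ a) (const-cong (*-inverseˡ a a≉0)))))
        (≋-trans (*ₚ-assoc (const a⁻¹) (const a) (P ^ₚ suc e))
        (≋-trans (*ₚ-congˡ (const a⁻¹) (≋-trans (≋-sym f≋aP^1+e) (mk≋ f≈δk₂)))
                 (solve 3 (λ A D K → A :* (D :* K) := D :* (A :* K)) ≋-refl (const a⁻¹) δ k₂))))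
      w = (u *ₚ k₁) +ₚ (v *ₚ (const a⁻¹ *ₚ k₂))
      1≋δw : 1ₚ ≋ δ *ₚ w
      1≋δw = ≋-trans (proj₂ (proj₂ (bezout-P^ g P∤g (suc e))))
        (≋-trans (+ₚ-cong (*ₚ-congˡ u (mk≋ g≈δk₁)) (*ₚ-congˡ v P^1+e≋δa⁻¹k₂))
                 (solve 5 (λ U D K V K′ → U :* (D :* K) :+ V :* (D :* K′) := D :* (U :* K :+ V :* K′)) ≋-refl u δ k₁ v (const a⁻¹ *ₚ k₂)))
      δw≉0 : ¬ (δ *ₚ w ≋ [])
      δw≉0 δw≈0 = 1≉0 (coeff-≈ (≋-trans 1≋δw δw≈0) 0)
      δ≉0 : ¬ (δ ≋ [])
      δ≉0 δ≈0 = δw≉0 (*ₚ-zeroˡ δ w δ≈0)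
      w≉0 : ¬ (w ≋ [])
      w≉0 w≈0 = δw≉0 (≋-trans (*ₚ-comm δ w) (*ₚ-zeroˡ w δ w≈0))


    deg-f : deg f ≡ suc e ℕ.* d
    deg-f = ≡.trans (deg-cong f≋aP^1+e) (≡.trans (deg-*ₚ (const a) (P ^ₚ suc e) (const≉0 a≉0) (monic⇒≉0 (P^-monic (suc e)))) (deg-P^ (suc e)))

    enumerates-coprimeBelow : ∀ {L} → Enumerates (InM f) L → Polys.Enumerates (CoprimeBelow (deg f)) L
    enumerates-coprimeBelow = Enumerates⇒ (λ g (monic , lt , coprime) → monic , lt , coprime⇒P∤ g coprime)
                                          (λ g (monic , lt , P∤g) → monic , lt , P∤⇒coprime g P∤g)

module PrimePowerModulus {c ℓ} (F : FiniteField c ℓ) (q-odd : ¬ (FiniteField.card F % 2 ≡ 0)) (P : Poly.Pol F)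
                         (P-monic : Poly.Monic F P) (P-irreducible : Poly.Irreducible F P) where
  open FiniteField F hiding (zero)
  open Poly F
  open PolynomialRing F
  open PolynomialPowers F
  open ModuloIrreducible F P P-monic P-irreducible
  open ResiduesOfMonics F P P-monic P-irreducible
  open CoprimeToPrimePower F P P-monic P-irreducible
  open import Algebra.Properties.CommutativeSemigroup ℕ.*-commutativeSemigroup using (xy∙z≈xz∙y)
  open import Relation.Binary.Reasoning.Setoid Residue.setoid

  M-aP^1+e : ∀ a → ¬ (a ≈ 0#) → ∀ e Lf LP → Enumerates (InM (const a *ₚ P ^ₚ suc e)) Lf → Enumerates (InM P) LP →
             Mof Lf ≡ᴾ const (signPow ((e ℕ.* ((card ∸ 1) / 2)) ℕ.* d)) *ₚ Mof LP
  M-aP^1+e a a≉0 e Lf LP enum-f enum-P = begin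
    prodₚ Lf ^ₚ N                                  ≈⟨ ^ₚ-cong-≡ᴾ N (∏-coprimeBelow q-odd (e ℕ.* d) LP enum-P′ Lf enum-f′) ⟩
    (prodₚ LP *ₚ (-1ₚ ^ₚ (e ℕ.* d))) ^ₚ N          ≈⟨ ≋⇒≡ᴾ (^ₚ-signPow (prodₚ LP) (e ℕ.* d) N) ⟩
    const (signPow ((e ℕ.* d) ℕ.* N)) *ₚ Mof LP    ≡⟨ ≡.cong (λ j → const (signPow j) *ₚ Mof LP) (xy∙z≈xz∙y e d N) ⟩
    const (signPow ((e ℕ.* N) ℕ.* d)) *ₚ Mof LP    ∎
    where
    N = (card ∸ 1) / 2
    enum-f′ : Polys.Enumerates (CoprimeBelow (d ℕ.+ e ℕ.* d)) Lf
    enum-f′ = ≡.subst (λ n → Polys.Enumerates (CoprimeBelow n) Lf) (deg-f a a≉0 e _ ≋-refl)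
                      (enumerates-coprimeBelow a a≉0 e _ ≋-refl enum-f)
    enum-P′ : Polys.Enumerates (CoprimeBelow d) LP
    enum-P′ = enumerates-coprimeBelow 1# 1≉0 0 P (≋-sym (≋-trans (*ₚ-identityˡ _) (*ₚ-identityʳ P))) enum-P


open import Data.Nat using (_*_)
open FiniteField using (Carrier; card; _≈_; 0#)
open Poly using (Pol; Monic; Irreducible; Enumerates; InM; const; _*ₚ_; _^ₚ_; Mof; signPow; deg; _≡_[modₚ_])

lemma4p4 : ∀ {c ℓ} (F : FiniteField c ℓ) →
    ¬ (card F % 2 ≡ 0) →
    (a : Carrier F) → ¬ (_≈_ F a (0# F)) →
    (P : Pol F) → Monic F P → Irreducible F P →
    (e : ℕ) → 1 ≤ e →
    (Lf LP : List (Pol F)) →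
    Enumerates F (InM F (_*ₚ_ F (const F a) (_^ₚ_ F P e))) Lf →
    Enumerates F (InM F P) LP →
    _≡_[modₚ_] F (Mof F Lf)
      (_*ₚ_ F (const F (signPow F (((e ∸ 1) * ((card F ∸ 1) / 2)) * deg F P))) (Mof F LP))
      P
lemma4p4 F q-odd a a≉0 P P-monic P-irreducible (suc e) _ Lf LP enum-f enum-P =
  ModuloIrreducible.≡ᴾ⇒≡[modₚ] F P P-monic P-irreducible
    (PrimePowerModulus.M-aP^1+e F q-odd P P-monic P-irreducible a a≉0 e Lf LP enum-f enum-P)
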